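{- There is a constant $\gamma>0$ such that if $E_n$ is a uniformly random subset of $\binom{[n]}{2}$, then the graph $G_n=([n],E_n)$ is $\gamma n$-robustly self-ordered with probability $1-\exp(-\Omega(n))$.
   Context: For $\rho>0$, a graph $G=(V,E)$ is $\rho$-robustly self-ordered if for every permutation $\pi:V\to V$, $|E\triangle\{\{\pi(u),\pi(v)\}:\{u,v\}\in E\}|\ge\rho\cdot|\{v:\pi(v)\ne v\}|$. -}

module Defs where

open import Data.Nat as ℕ using (ℕ; zero; suc; _<ᵇ_)
open import Data.Nat.Combinatorics using (_C_)
open import Data.Bool using (Bool; true; false; if_then_else_; _∧_; _xor_; not)
open import Data.Fin using (Fin; toℕ; _≟_)
open import Data.Fin.Permutation using (Permutation′; _⟨$⟩ˡ_)
open import Data.List using (List; map; concatMap; allFin; length)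
open import Data.List.Membership.Propositional using (_∈_)
open import Data.Nat.ListAction using (sum)
open import Data.Vec using (Vec; lookup)
open import Data.Integer using (+_)
open import Data.Rational using (ℚ; _/_; _*_; _≤_; 1ℚ)
open import Relation.Nullary.Decidable using (⌊_⌋)
open import Relation.Binary.PropositionalEquality using (_≡_)

ℕ→ℚ : ℕ → ℚ
ℕ→ℚ k = + k / 1

_^ℚ_ : ℚ → ℕ → ℚ
q ^ℚ zero = 1ℚ
q ^ℚ suc k = q * (q ^ℚ k)

Adj : ℕ → Set
Adj n = Vec (Vec Bool n) n

adj : ∀ {n} → Adj n → Fin n → Fin n → Bool
adj A u v = lookup (lookup A u) v

-- A is a simple graph: symmetric, no loops.  Such A correspond exactly to
-- subsets E of binom([n],2); there are 2^(n C 2) of them.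
IsSimple : ∀ {n} → Adj n → Set
IsSimple {n} A = (∀ (u v : Fin n) → adj A u v ≡ adj A v u) × (∀ (u : Fin n) → adj A u u ≡ false)
  where open import Data.Product using (_×_)

-- |E △ π(E)| where π(E) = {{π u, π v} : {u,v} ∈ E}:
-- a pair {x,y} (x<y) lies in π(E) iff {π⁻¹ x, π⁻¹ y} ∈ E.
symDiffSize : ∀ {n} → Adj n → Permutation′ n → ℕ
symDiffSize {n} A π =
  sum (concatMap (λ x → map (λ y →
        if (toℕ x <ᵇ toℕ y) ∧ (adj A x y xor adj A (π ⟨$⟩ˡ x) (π ⟨$⟩ˡ y)) then 1 else 0)
      (allFin n)) (allFin n))

-- |{v : π(v) ≠ v}|  (π(v) ≠ v iff π⁻¹(v) ≠ v)
movedCount : ∀ {n} → Permutation′ n → ℕ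
movedCount {n} π = sum (map (λ v → if ⌊ π ⟨$⟩ˡ v ≟ v ⌋ then 0 else 1) (allFin n))

RobustlySelfOrdered : ∀ {n} → ℚ → Adj n → Set
RobustlySelfOrdered {n} ρ A =
  ∀ (π : Permutation′ n) → ρ * ℕ→ℚ (movedCount π) ≤ ℕ→ℚ (symDiffSize A π)

-- The number of "bad" simple graphs on [n] (those which are not ρ-robustly
-- self-ordered) is at most B: some list of length ≤ B contains all of them.
BadCountAtMost : ℕ → ℚ → ℚ → Set
BadCountAtMost n ρ B =
  Σ (List (Adj n)) λ L →
    (ℕ→ℚ (length L) ≤ B) ×
    (∀ (A : Adj n) → IsSimple A → ¬ RobustlySelfOrdered ρ A → A ∈ L)
  where open import Data.Product using (Σ; _×_)
        open import Relation.Nullary using (¬_)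

-- Compression argument, with γ = 1/200 and q = 63/64.  Let σ move k vertices of G with
-- |E △ σ(E)| < kn/200, and orient [n] upwards or downwards.  The adjacency of a pair whose ranks σ
-- does not decrease, and strictly increases for at least one endpoint, equals that of its σ-image
-- up to a discrepancy; as the rank sum grows, iterating reaches a pair stored explicitly.  In the
-- better of the two orientations at least k(n − 2)/8 pairs are of this kind, so G is described by σ on
-- the moved vertices (n^{2k} choices), the orientation, the other pairs' bits and at most (n/200 + 1)k
-- discrepant pairs: at most n^{2k} · 2 · 2^{n choose 2} · 8^{(n/200+1)k} · (15/16)^{k(n−2)} graphs.
-- Summed over k ≥ 1 this is at most (63/64)^n · 2^{n choose 2} once n ≥ 531.
module Submission where

open import Defs
open import Data.Nat using (ℕ)
open import Data.Fin using (Fin)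
open import Data.Bool using (Bool)

module ListSums where

  open import Data.Nat
  open import Data.Nat.Properties
  open import Data.Nat.ListAction using (sum)
  open import Data.Nat.ListAction.Properties using (sum-++)
  open import Data.Bool using (Bool; true; false; T; if_then_else_; _∧_; not)
  open import Data.List using (List; []; _∷_; map; concatMap; length; _++_; filterᵇ)
  open import Data.List.Properties using (length-++; length-map)
  open import Data.List.Membership.Propositional using (_∈_)
  open import Data.List.Membership.Propositional.Properties using (∈-++⁺ˡ; ∈-++⁺ʳ; ∈-map⁺)
  open import Data.List.Relation.Unary.Any using (here; there)
  open import Function using (_∘′_)
  open import Relation.Binary.PropositionalEquality
  open import Data.Nat.Solver using (module +-*-Solver)
  open +-*-Solver

  𝟙 : Bool → ℕ
  𝟙 b = if b then 1 else 0

  sumOver : ∀ {A : Set} → List A → (A → ℕ) → ℕ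
  sumOver xs f = sum (map f xs)

  module _ {A : Set} where

    sumOver-cong : ∀ (xs : List A) {f g : A → ℕ} → (∀ x → f x ≡ g x) → sumOver xs f ≡ sumOver xs g
    sumOver-cong [] e = refl
    sumOver-cong (x ∷ xs) e = cong₂ _+_ (e x) (sumOver-cong xs e)

    sumOver-mono : ∀ (xs : List A) {f g : A → ℕ} → (∀ x → f x ≤ g x) → sumOver xs f ≤ sumOver xs g
    sumOver-mono [] e = z≤n
    sumOver-mono (x ∷ xs) e = +-mono-≤ (e x) (sumOver-mono xs e)

    sumOver-+ : ∀ (xs : List A) (f g : A → ℕ) → sumOver xs (λ x → f x + g x) ≡ sumOver xs f + sumOver xs g
    sumOver-+ [] f g = refl
    sumOver-+ (x ∷ xs) f g rewrite sumOver-+ xs f g =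
      solve 4 (λ a b c d → a :+ b :+ (c :+ d) := a :+ c :+ (b :+ d)) refl (f x) (g x) (sumOver xs f) (sumOver xs g)

    sumOver-*ˡ : ∀ (xs : List A) (c : ℕ) (f : A → ℕ) → sumOver xs (λ x → c * f x) ≡ c * sumOver xs f
    sumOver-*ˡ [] c f = sym (*-zeroʳ c)
    sumOver-*ˡ (x ∷ xs) c f rewrite sumOver-*ˡ xs c f = sym (*-distribˡ-+ c (f x) (sumOver xs f))

    sumOver-*ʳ : ∀ (xs : List A) (c : ℕ) (f : A → ℕ) → sumOver xs (λ x → f x * c) ≡ sumOver xs f * c
    sumOver-*ʳ xs c f = trans (sumOver-cong xs (λ x → *-comm (f x) c)) (trans (sumOver-*ˡ xs c f) (*-comm c (sumOver xs f)))

    sumOver-const : ∀ (xs : List A) (c : ℕ) → sumOver xs (λ _ → c) ≡ length xs * c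
    sumOver-const [] c = refl
    sumOver-const (x ∷ xs) c = cong (c +_) (sumOver-const xs c)

    sumOver-𝟙 : ∀ (xs : List A) (p : A → Bool) → sumOver xs (λ x → 𝟙 (p x)) ≡ length (filterᵇ p xs)
    sumOver-𝟙 [] p = refl
    sumOver-𝟙 (x ∷ xs) p with p x
    ... | true = cong suc (sumOver-𝟙 xs p)
    ... | false = sumOver-𝟙 xs p

    sumOver-*-≤ : ∀ (xs : List A) (f : A → ℕ) (w m : ℕ) → (∀ x → f x * w ≤ m) → sumOver xs f * w ≤ length xs * m
    sumOver-*-≤ [] f w m h = z≤n
    sumOver-*-≤ (x ∷ xs) f w m h = begin
        (f x + sumOver xs f) * w   ≡⟨ *-distribʳ-+ w (f x) (sumOver xs f) ⟩
        f x * w + sumOver xs f * w ≤⟨ +-mono-≤ (h x) (sumOver-*-≤ xs f w m h) ⟩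
        m + length xs * m          ∎
      where open ≤-Reasoning

    length-filterᵇ-split : ∀ (p : A → Bool) xs → length (filterᵇ p xs) + length (filterᵇ (not ∘′ p) xs) ≡ length xs
    length-filterᵇ-split p [] = refl
    length-filterᵇ-split p (x ∷ xs) with p x
    ... | true = cong suc (length-filterᵇ-split p xs)
    ... | false = trans (+-suc _ _) (cong suc (length-filterᵇ-split p xs))

    filterᵇ-filterᵇ : ∀ (p q : A → Bool) xs → filterᵇ p (filterᵇ q xs) ≡ filterᵇ (λ x → q x ∧ p x) xs
    filterᵇ-filterᵇ p q [] = refl
    filterᵇ-filterᵇ p q (x ∷ xs) with q x
    ... | false = filterᵇ-filterᵇ p q xs
    ... | true with p x
    ...   | true = cong (x ∷_) (filterᵇ-filterᵇ p q xs)
    ...   | false = filterᵇ-filterᵇ p q xs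

    length-filterᵇ-mono : ∀ (p q : A → Bool) → (∀ x → T (p x) → T (q x)) → ∀ xs → length (filterᵇ p xs) ≤ length (filterᵇ q xs)
    length-filterᵇ-mono p q p⇒q [] = z≤n
    length-filterᵇ-mono p q p⇒q (x ∷ xs) with p x in px | q x in qx
    ... | true  | true  = s≤s (length-filterᵇ-mono p q p⇒q xs)
    ... | true  | false = contradiction′ (subst T qx (p⇒q x (subst T (sym px) _)))
      where contradiction′ : ∀ {B : Set} → T false → B
            contradiction′ ()
    ... | false | true  = m≤n⇒m≤1+n (length-filterᵇ-mono p q p⇒q xs)
    ... | false | false = length-filterᵇ-mono p q p⇒q xs

  module _ {A B : Set} where

    sumOver-map : ∀ (xs : List A) (h : A → B) (g : B → ℕ) → sumOver (map h xs) g ≡ sumOver xs (λ x → g (h x))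
    sumOver-map [] h g = refl
    sumOver-map (x ∷ xs) h g = cong (g (h x) +_) (sumOver-map xs h g)

    sumOver-++ : ∀ (xs ys : List B) (g : B → ℕ) → sumOver (xs ++ ys) g ≡ sumOver xs g + sumOver ys g
    sumOver-++ [] ys g = refl
    sumOver-++ (x ∷ xs) ys g = trans (cong (g x +_) (sumOver-++ xs ys g)) (sym (+-assoc (g x) _ _))

    sumOver-concatMap : ∀ (xs : List A) (f : A → List B) (g : B → ℕ) → sumOver (concatMap f xs) g ≡ sumOver xs (λ x → sumOver (f x) g)
    sumOver-concatMap [] f g = refl
    sumOver-concatMap (x ∷ xs) f g = trans (sumOver-++ (f x) (concatMap f xs) g) (cong (sumOver (f x) g +_) (sumOver-concatMap xs f g))

    length-concatMap : ∀ (xs : List A) (f : A → List B) → length (concatMap f xs) ≡ sumOver xs (λ x → length (f x))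
    length-concatMap [] f = refl
    length-concatMap (x ∷ xs) f = trans (length-++ (f x)) (cong (length (f x) +_) (length-concatMap xs f))

    sumOver-comm : ∀ (xs : List A) (ys : List B) (h : A → B → ℕ) →
                   sumOver xs (λ x → sumOver ys (λ y → h x y)) ≡ sumOver ys (λ y → sumOver xs (λ x → h x y))
    sumOver-comm [] ys h = sym (trans (sumOver-const ys 0) (*-zeroʳ (length ys)))
    sumOver-comm (x ∷ xs) ys h = trans (cong (sumOver ys (h x) +_) (sumOver-comm xs ys h)) (sym (sumOver-+ ys (h x) _))

    ∈-concatMap⁺ : ∀ (f : A → List B) {x y} xs → x ∈ xs → y ∈ f x → y ∈ concatMap f xs
    ∈-concatMap⁺ f (x ∷ xs) (here refl) m = ∈-++⁺ˡ m
    ∈-concatMap⁺ f (x ∷ xs) (there mx) m = ∈-++⁺ʳ (f x) (∈-concatMap⁺ f xs mx m)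

  sum-concatMap : ∀ {A : Set} (xs : List A) (f : A → List ℕ) → sum (concatMap f xs) ≡ sumOver xs (λ x → sum (f x))
  sum-concatMap [] f = refl
  sum-concatMap (x ∷ xs) f = trans (sum-++ (f x) (concatMap f xs)) (cong (sum (f x) +_) (sum-concatMap xs f))

  listsOfLength : ∀ {A : Set} → ℕ → List A → List (List A)
  listsOfLength zero xs = [] ∷ []
  listsOfLength (suc k) xs = concatMap (λ x → map (x ∷_) (listsOfLength k xs)) xs

  length-listsOfLength : ∀ {A : Set} k (xs : List A) → length (listsOfLength k xs) ≡ length xs ^ k
  length-listsOfLength zero xs = refl
  length-listsOfLength (suc k) xs = begin
      length (listsOfLength (suc k) xs)                          ≡⟨ length-concatMap xs _ ⟩
      sumOver xs (λ x → length (map (x ∷_) (listsOfLength k xs)))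
        ≡⟨ sumOver-cong xs (λ x → trans (length-map (x ∷_) (listsOfLength k xs)) (length-listsOfLength k xs)) ⟩
      sumOver xs (λ _ → length xs ^ k)                           ≡⟨ sumOver-const xs _ ⟩
      length xs * length xs ^ k                                  ∎
    where open ≡-Reasoning

  ∈-listsOfLength : ∀ {A : Set} (xs : List A) → (∀ x → x ∈ xs) → ∀ l → l ∈ listsOfLength (length l) xs
  ∈-listsOfLength xs complete [] = here refl
  ∈-listsOfLength xs complete (y ∷ l) =
    ∈-concatMap⁺ (λ x → map (x ∷_) (listsOfLength (length l) xs)) xs (complete y) (∈-map⁺ (y ∷_) (∈-listsOfLength xs complete l))

  bools : List Bool
  bools = true ∷ false ∷ []

  ∈-bools : ∀ b → b ∈ bools
  ∈-bools true = here refl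
  ∈-bools false = there (here refl)

  sublistsUpTo : ∀ {A : Set} → ℕ → List A → List (List A)
  sublistsUpTo d [] = [] ∷ []
  sublistsUpTo zero (x ∷ xs) = [] ∷ []
  sublistsUpTo (suc d) (x ∷ xs) = map (x ∷_) (sublistsUpTo d xs) ++ sublistsUpTo (suc d) xs

  -- sublistCount d m = Σ_{i ≤ d} (m choose i)
  sublistCount : ℕ → ℕ → ℕ
  sublistCount d zero = 1
  sublistCount zero (suc m) = 1
  sublistCount (suc d) (suc m) = sublistCount d m + sublistCount (suc d) m

  length-sublistsUpTo : ∀ {A : Set} d (xs : List A) → length (sublistsUpTo d xs) ≡ sublistCount d (length xs)
  length-sublistsUpTo d [] = refl
  length-sublistsUpTo zero (x ∷ xs) = refl
  length-sublistsUpTo (suc d) (x ∷ xs) =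
    trans (length-++ (map (x ∷_) (sublistsUpTo d xs)))
          (cong₂ _+_ (trans (length-map (x ∷_) (sublistsUpTo d xs)) (length-sublistsUpTo d xs)) (length-sublistsUpTo (suc d) xs))

  filterᵇ-∈-sublistsUpTo : ∀ {A : Set} (p : A → Bool) d xs → length (filterᵇ p xs) ≤ d → filterᵇ p xs ∈ sublistsUpTo d xs
  filterᵇ-∈-sublistsUpTo p d [] _ = here refl
  filterᵇ-∈-sublistsUpTo p zero (x ∷ xs) h with p x
  filterᵇ-∈-sublistsUpTo p zero (x ∷ xs) () | true
  ... | false with filterᵇ p xs | h
  ...   | [] | _ = here refl
  filterᵇ-∈-sublistsUpTo p (suc d) (x ∷ xs) h with p x
  ... | true = ∈-++⁺ˡ (∈-map⁺ (x ∷_) (filterᵇ-∈-sublistsUpTo p d xs (s≤s⁻¹ h)))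
  ... | false = ∈-++⁺ʳ (map (x ∷_) (sublistsUpTo d xs)) (filterᵇ-∈-sublistsUpTo p (suc d) xs h)

  -- Σ_{i ≤ d} (m choose i) ≤ 8^d Σ_i (m choose i) 8^{-i} = 8^d (9/8)^m.
  sublistCount-bound : ∀ d m → 8 ^ m * sublistCount d m ≤ 8 ^ d * 9 ^ m
  sublistCount-bound d zero = subst (_≤ 8 ^ d * 1) (sym (*-identityʳ 1)) (subst (1 ≤_) (sym (*-identityʳ (8 ^ d))) (m^n>0 8 d))
  sublistCount-bound zero (suc m) =
    subst₂ _≤_ (sym (*-identityʳ (8 ^ suc m))) (sym (*-identityˡ (9 ^ suc m))) (^-monoˡ-≤ (suc m) (n≤1+n 8))
  sublistCount-bound (suc d) (suc m) = begin
      8 ^ suc m * (sublistCount d m + sublistCount (suc d) m)                       ≡⟨ regroup (8 ^ m) (sublistCount d m) (sublistCount (suc d) m) ⟩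
      8 * (8 ^ m * sublistCount d m) + 8 * (8 ^ m * sublistCount (suc d) m)
        ≤⟨ +-mono-≤ (*-monoʳ-≤ 8 (sublistCount-bound d m)) (*-monoʳ-≤ 8 (sublistCount-bound (suc d) m)) ⟩
      8 * (8 ^ d * 9 ^ m) + 8 * (8 ^ suc d * 9 ^ m)                                 ≡⟨ collect (8 ^ d) (9 ^ m) ⟩
      8 ^ suc d * 9 ^ suc m                                                         ∎
    where
    open ≤-Reasoning
    regroup : ∀ e a b → 8 * e * (a + b) ≡ 8 * (e * a) + 8 * (e * b)
    regroup = solve 3 (λ e a b → con 8 :* e :* (a :+ b) := con 8 :* (e :* a) :+ con 8 :* (e :* b)) refl
    collect : ∀ a b → 8 * (a * b) + 8 * (8 * a * b) ≡ 8 * a * (9 * b)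
    collect = solve 2 (λ a b → con 8 :* (a :* b) :+ con 8 :* (con 8 :* a :* b) := con 8 :* a :* (con 9 :* b)) refl

module Estimates where

  open import Data.Nat
  open import Data.Nat.Properties
  open import Data.Nat.DivMod using (m/n≡1+[m∸n]/n; m≡m%n+[m/n]*n; m%n<n)
  open import Data.Nat.Induction using (<-rec)
  open import Data.Bool using (Bool; true; T; _∧_)
  open import Data.Unit using (tt)
  open import Relation.Nullary using (yes; no)
  open import Relation.Binary.PropositionalEquality
  open import Data.Nat.Solver using (module +-*-Solver)
  open +-*-Solver using (solve; _:*_; _:+_; con; _:=_)
  open ListSums using (sublistCount; sublistCount-bound)

  ^-distribʳ-* : ∀ a b t → (a * b) ^ t ≡ a ^ t * b ^ t
  ^-distribʳ-* a b zero = refl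
  ^-distribʳ-* a b (suc t) rewrite ^-distribʳ-* a b t =
    solve 4 (λ a b x y → a :* b :* (x :* y) := a :* x :* (b :* y)) refl a b (a ^ t) (b ^ t)

  9/16≤[15/16]^8 : ∀ t → 9 ^ t * 16 ^ (8 * t) ≤ 16 ^ t * 15 ^ (8 * t)
  9/16≤[15/16]^8 t = begin
      9 ^ t * 16 ^ (8 * t)    ≡⟨ cong (9 ^ t *_) (sym (^-*-assoc 16 8 t)) ⟩
      9 ^ t * (16 ^ 8) ^ t    ≡⟨ sym (^-distribʳ-* 9 (16 ^ 8) t) ⟩
      (9 * 16 ^ 8) ^ t        ≤⟨ ^-monoˡ-≤ t (≤ᵇ⇒≤ (9 * 16 ^ 8) (16 * 15 ^ 8) tt) ⟩
      (16 * 15 ^ 8) ^ t       ≡⟨ ^-distribʳ-* 16 (15 ^ 8) t ⟩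
      16 ^ t * (15 ^ 8) ^ t   ≡⟨ cong (16 ^ t *_) (^-*-assoc 15 8 t) ⟩
      16 ^ t * 15 ^ (8 * t)   ∎
    where open ≤-Reasoning

  [15/16]^-antitone : ∀ a b K r → a * 16 ^ (K + r) ≤ b * 15 ^ (K + r) → a * 16 ^ K ≤ b * 15 ^ K
  [15/16]^-antitone a b K r h = *-cancelʳ-≤ _ _ (15 ^ r) {{m^n≢0 15 r}} (begin
      a * 16 ^ K * 15 ^ r     ≤⟨ *-monoʳ-≤ (a * 16 ^ K) (^-monoˡ-≤ r (n≤1+n 15)) ⟩
      a * 16 ^ K * 16 ^ r     ≡⟨ trans (*-assoc a _ _) (cong (a *_) (sym (^-distribˡ-+-* 16 K r))) ⟩
      a * 16 ^ (K + r)        ≤⟨ h ⟩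
      b * 15 ^ (K + r)        ≡⟨ trans (cong (b *_) (^-distribˡ-+-* 15 K r)) (sym (*-assoc b _ _)) ⟩
      b * 15 ^ K * 15 ^ r     ∎)
    where open ≤-Reasoning

  -- 2^m Σ_{i ≤ d} (t choose i) ≤ 2^P 8^d (9/16)^t, and 9/16 ≤ (15/16)^8.
  block-bound : ∀ m t P K d → m + t ≡ P → K ≤ 8 * t →
                2 ^ m * sublistCount d t * 16 ^ K ≤ 2 ^ P * 8 ^ d * 15 ^ K
  block-bound m t P K d m+t≡P K≤8t =
    [15/16]^-antitone (2 ^ m * s) X K (8 * t ∸ K)
      (subst (λ e → 2 ^ m * s * 16 ^ e ≤ X * 15 ^ e) (sym (m+[n∸m]≡n K≤8t)) at-8t)
    where
    s = sublistCount d t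
    X = 2 ^ P * 8 ^ d
    at-t : 2 ^ m * s * 16 ^ t ≤ X * 9 ^ t
    at-t = begin
        2 ^ m * s * 16 ^ t             ≡⟨ cong (2 ^ m * s *_) (^-distribʳ-* 2 8 t) ⟩
        2 ^ m * s * (2 ^ t * 8 ^ t)    ≡⟨ solve 4 (λ a b c e → a :* b :* (c :* e) := (a :* c) :* (e :* b)) refl (2 ^ m) s (2 ^ t) (8 ^ t) ⟩
        (2 ^ m * 2 ^ t) * (8 ^ t * s)  ≡⟨ cong (_* (8 ^ t * s)) (trans (sym (^-distribˡ-+-* 2 m t)) (cong (2 ^_) m+t≡P)) ⟩
        2 ^ P * (8 ^ t * s)            ≤⟨ *-monoʳ-≤ (2 ^ P) (sublistCount-bound d t) ⟩
        2 ^ P * (8 ^ d * 9 ^ t)        ≡⟨ sym (*-assoc (2 ^ P) _ _) ⟩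
        X * 9 ^ t                      ∎
      where open ≤-Reasoning
    at-8t : 2 ^ m * s * 16 ^ (8 * t) ≤ X * 15 ^ (8 * t)
    at-8t = *-cancelʳ-≤ _ _ (16 ^ t) {{m^n≢0 16 t}} (begin
        2 ^ m * s * 16 ^ (8 * t) * 16 ^ t    ≡⟨ swap₂ (2 ^ m * s) (16 ^ (8 * t)) (16 ^ t) ⟩
        2 ^ m * s * 16 ^ t * 16 ^ (8 * t)    ≤⟨ *-monoˡ-≤ (16 ^ (8 * t)) at-t ⟩
        X * 9 ^ t * 16 ^ (8 * t)             ≡⟨ *-assoc X _ _ ⟩
        X * (9 ^ t * 16 ^ (8 * t))           ≤⟨ *-monoʳ-≤ X (9/16≤[15/16]^8 t) ⟩
        X * (16 ^ t * 15 ^ (8 * t))          ≡⟨ trans (sym (*-assoc X _ _)) (swap₂ X (16 ^ t) (15 ^ (8 * t))) ⟩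
        X * 15 ^ (8 * t) * 16 ^ t            ∎)
      where
      open ≤-Reasoning
      swap₂ : ∀ a b c → a * b * c ≡ a * c * b
      swap₂ = solve 3 (λ a b c → a :* b :* c := a :* c :* b) refl

  budget : ℕ → ℕ
  budget n = n / 200 + 1

  n≤200*budget : ∀ n → n ≤ 200 * budget n
  n≤200*budget n = begin
      n                           ≡⟨ m≡m%n+[m/n]*n n 200 ⟩
      n % 200 + n / 200 * 200     ≤⟨ +-monoˡ-≤ (n / 200 * 200) (<⇒≤ (m%n<n n 200)) ⟩
      200 + n / 200 * 200         ≡⟨ solve 1 (λ q → con 200 :+ q :* con 200 := con 200 :* (q :+ con 1)) refl (n / 200) ⟩
      200 * budget n              ∎
    where open ≤-Reasoning

  budget-+200 : ∀ m → budget (m + 200) ≡ suc (budget m)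
  budget-+200 m = cong (_+ 1) (trans (m/n≡1+[m∸n]/n (m≤n+m 200 m)) (cong (λ z → 1 + z / 200) (m+n∸n≡m m 200)))

  cube : ℕ → ℕ
  cube x = x * x * x

  cube-mono : ∀ {x y} → x ≤ y → cube x ≤ cube y
  cube-mono h = *-mono-≤ (*-mono-≤ h h) h

  decayLhs decayRhs : ℕ → ℕ
  decayLhs n = 2 * cube n * 8 ^ budget n * 15 ^ (n ∸ 2) * 64 ^ n
  decayRhs n = 63 ^ n * 16 ^ (n ∸ 2)

  allBelowᵇ : (ℕ → Bool) → ℕ → Bool
  allBelowᵇ f zero = true
  allBelowᵇ f (suc k) = f k ∧ allBelowᵇ f k

  allBelowᵇ-sound : ∀ f k r → T (allBelowᵇ f k) → r < k → T (f r)
  allBelowᵇ-sound f (suc k) r h r<k with f k in fk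
  ... | true with r ≟ k
  ...   | yes refl rewrite fk = tt
  ...   | no r≢k = allBelowᵇ-sound f k r h (≤∧≢⇒< (s≤s⁻¹ r<k) r≢k)

  decay-base : ∀ r → r < 200 → decayLhs (531 + r) ≤ decayRhs (531 + r)
  decay-base r r<200 = ≤ᵇ⇒≤ _ _ (allBelowᵇ-sound checks 200 r tt r<200)
    where
    checks : ℕ → Bool
    checks r = decayLhs (531 + r) ≤ᵇ decayRhs (531 + r)

  decayLhs-+200 : ∀ m → 531 ≤ m → decayLhs (m + 200) * cube 531 ≤ decayLhs m * (cube 731 * 8 * 15 ^ 200 * 64 ^ 200)
  decayLhs-+200 m lo = begin
      decayLhs (m + 200) * cube 531
        ≡⟨ cong₂ (λ e f → 2 * cube (m + 200) * 8 ^ e * 15 ^ f * 64 ^ (m + 200) * cube 531) (budget-+200 m) m+200∸2 ⟩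
      2 * cube (m + 200) * (8 * E) * 15 ^ (m ∸ 2 + 200) * 64 ^ (m + 200) * cube 531
        ≡⟨ cong₂ (λ u v → 2 * cube (m + 200) * (8 * E) * u * v * cube 531) (^-distribˡ-+-* 15 (m ∸ 2) 200) (^-distribˡ-+-* 64 m 200) ⟩
      2 * cube (m + 200) * (8 * E) * (G * 15 ^ 200) * (H * 64 ^ 200) * cube 531
        ≡⟨ regroup (m + 200) E G (15 ^ 200) H (64 ^ 200) 531 ⟩
      (2 * 8 * E * G * H * 15 ^ 200 * 64 ^ 200) * cube ((m + 200) * 531)
        ≤⟨ *-monoʳ-≤ (2 * 8 * E * G * H * 15 ^ 200 * 64 ^ 200) (cube-mono linear) ⟩
      (2 * 8 * E * G * H * 15 ^ 200 * 64 ^ 200) * cube (m * 731)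
        ≡⟨ ungroup m E G (15 ^ 200) H (64 ^ 200) 731 ⟩
      decayLhs m * (cube 731 * 8 * 15 ^ 200 * 64 ^ 200) ∎
    where
    open ≤-Reasoning
    E = 8 ^ budget m
    G = 15 ^ (m ∸ 2)
    H = 64 ^ m
    m+200∸2 : m + 200 ∸ 2 ≡ m ∸ 2 + 200
    m+200∸2 = +-∸-comm 200 (≤-trans (s≤s (s≤s z≤n)) lo)
    linear : (m + 200) * 531 ≤ m * 731
    linear = begin
        (m + 200) * 531    ≡⟨ *-distribʳ-+ 531 m 200 ⟩
        m * 531 + 106200   ≤⟨ +-monoʳ-≤ (m * 531) (*-monoʳ-≤ 200 lo) ⟩
        m * 531 + 200 * m  ≡⟨ solve 1 (λ m → m :* con 531 :+ con 200 :* m := m :* con 731) refl m ⟩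
        m * 731            ∎
    regroup : ∀ x E G a H b c → 2 * cube x * (8 * E) * (G * a) * (H * b) * cube c ≡ (2 * 8 * E * G * H * a * b) * cube (x * c)
    regroup = solve 7 (λ x E G a H b c → con 2 :* (x :* x :* x) :* (con 8 :* E) :* (G :* a) :* (H :* b) :* (c :* c :* c)
                                      := (con 2 :* con 8 :* E :* G :* H :* a :* b) :* ((x :* c) :* (x :* c) :* (x :* c))) refl
    ungroup : ∀ x E G a H b d → (2 * 8 * E * G * H * a * b) * cube (x * d) ≡ (2 * cube x * E * G * H) * (cube d * 8 * a * b)
    ungroup = solve 7 (λ x E G a H b d → (con 2 :* con 8 :* E :* G :* H :* a :* b) :* ((x :* d) :* (x :* d) :* (x :* d))
                                      := (con 2 :* (x :* x :* x) :* E :* G :* H) :* ((d :* d :* d) :* con 8 :* a :* b)) refl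

  decayRhs-+200 : ∀ m → 2 ≤ m → decayRhs (m + 200) ≡ decayRhs m * (63 ^ 200 * 16 ^ 200)
  decayRhs-+200 m 2≤m = begin
      63 ^ (m + 200) * 16 ^ (m + 200 ∸ 2)           ≡⟨ cong (λ e → 63 ^ (m + 200) * 16 ^ e) (+-∸-comm 200 2≤m) ⟩
      63 ^ (m + 200) * 16 ^ (m ∸ 2 + 200)           ≡⟨ cong₂ _*_ (^-distribˡ-+-* 63 m 200) (^-distribˡ-+-* 16 (m ∸ 2) 200) ⟩
      63 ^ m * 63 ^ 200 * (16 ^ (m ∸ 2) * 16 ^ 200)
        ≡⟨ solve 4 (λ a b c d → a :* b :* (c :* d) := a :* c :* (b :* d)) refl (63 ^ m) (63 ^ 200) (16 ^ (m ∸ 2)) (16 ^ 200) ⟩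
      decayRhs m * (63 ^ 200 * 16 ^ 200)            ∎
    where open ≡-Reasoning

  decay-step : ∀ m → 531 ≤ m → decayLhs m ≤ decayRhs m → decayLhs (m + 200) ≤ decayRhs (m + 200)
  decay-step m lo ih = *-cancelʳ-≤ _ _ (cube 531) (begin
      decayLhs (m + 200) * cube 531                          ≤⟨ decayLhs-+200 m lo ⟩
      decayLhs m * (cube 731 * 8 * 15 ^ 200 * 64 ^ 200)      ≤⟨ *-mono-≤ ih (≤ᵇ⇒≤ _ _ tt) ⟩
      decayRhs m * (cube 531 * (63 ^ 200 * 16 ^ 200))        ≡⟨ solve 3 (λ a b c → a :* (b :* c) := a :* c :* b) refl (decayRhs m) (cube 531) (63 ^ 200 * 16 ^ 200) ⟩
      decayRhs m * (63 ^ 200 * 16 ^ 200) * cube 531          ≡⟨ cong (_* cube 531) (sym (decayRhs-+200 m (≤-trans (s≤s (s≤s z≤n)) lo))) ⟩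
      decayRhs (m + 200) * cube 531                          ∎)
    where open ≤-Reasoning

  -- Checked by evaluation on [531, 731), and propagated in steps of 200.
  decay : ∀ n → 531 ≤ n → decayLhs n ≤ decayRhs n
  decay = <-rec (λ n → 531 ≤ n → decayLhs n ≤ decayRhs n) go
    where
    go : ∀ n → (∀ {m} → m < n → 531 ≤ m → decayLhs m ≤ decayRhs m) → 531 ≤ n → decayLhs n ≤ decayRhs n
    go n rec lo with n <? 731
    ... | yes n<731 = subst (λ z → decayLhs z ≤ decayRhs z) (m+[n∸m]≡n lo) (decay-base (n ∸ 531) (∸-monoˡ-< n<731 lo))
    ... | no n≮731 = subst (λ z → decayLhs z ≤ decayRhs z) (m∸n+n≡m 200≤n) (decay-step (n ∸ 200) lo′ (rec n∸200<n lo′))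
      where
      200≤n : 200 ≤ n
      200≤n = ≤-trans (m≤m+n 200 531) (≮⇒≥ n≮731)
      lo′ : 531 ≤ n ∸ 200
      lo′ = ∸-monoˡ-≤ 200 (≮⇒≥ n≮731)
      n∸200<n : n ∸ 200 < n
      n∸200<n = ∸-monoʳ-< {n} {200} {0} z<s 200≤n

  geometric-level : ∀ {L X B Q F} P j .{{_ : NonZero Q}} .{{_ : NonZero F}} → Q ≤ B → 2 * (X * B) ≤ Q * F →
                    L * F ^ suc j ≤ 2 * (2 ^ P * X ^ suc j) → L * B ≤ Q * 2 ^ P
  geometric-level {L} {X} {B} {Q} {F} P j Q≤B 2XB≤QF hyp = *-cancelʳ-≤ _ _ (Q ^ j * F ^ k) {{m*n≢0 (Q ^ j) (F ^ k) {{m^n≢0 Q j}} {{m^n≢0 F k}}}} (begin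
      L * B * (Q ^ j * F ^ k)               ≡⟨ solve 4 (λ L B x y → L :* B :* (x :* y) := (L :* y) :* (B :* x)) refl L B (Q ^ j) (F ^ k) ⟩
      (L * F ^ k) * (B * Q ^ j)             ≤⟨ *-mono-≤ hyp (*-monoʳ-≤ B (^-monoˡ-≤ j Q≤B)) ⟩
      2 * (2 ^ P * X ^ k) * (B * B ^ j)     ≡⟨ solve 3 (λ p x c → con 2 :* (p :* x) :* c := p :* (con 2 :* (x :* c))) refl (2 ^ P) (X ^ k) (B ^ k) ⟩
      2 ^ P * (2 * (X ^ k * B ^ k))         ≡⟨ cong (λ z → 2 ^ P * (2 * z)) (sym (^-distribʳ-* X B k)) ⟩
      2 ^ P * (2 * (X * B) ^ k)             ≤⟨ *-monoʳ-≤ (2 ^ P) (*-monoˡ-≤ ((X * B) ^ k) (^-monoʳ-≤ 2 {1} {k} (s≤s z≤n))) ⟩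
      2 ^ P * (2 ^ k * (X * B) ^ k)         ≡⟨ cong (2 ^ P *_) (sym (^-distribʳ-* 2 (X * B) k)) ⟩
      2 ^ P * (2 * (X * B)) ^ k             ≤⟨ *-monoʳ-≤ (2 ^ P) (^-monoˡ-≤ k 2XB≤QF) ⟩
      2 ^ P * (Q * F) ^ k                   ≡⟨ cong (2 ^ P *_) (^-distribʳ-* Q F k) ⟩
      2 ^ P * (Q * Q ^ j * F ^ k)           ≡⟨ solve 4 (λ p q x y → p :* (q :* x :* y) := q :* p :* (x :* y)) refl (2 ^ P) Q (Q ^ j) (F ^ k) ⟩
      Q * 2 ^ P * (Q ^ j * F ^ k)           ∎)
    where
    open ≤-Reasoning
    k = suc j

  square-gap : ∀ k b → 1 ≤ k → k ≤ b → k * k + 2 * b ≤ b * b + 2 * k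
  square-gap k b 1≤k k≤b = subst (λ c → k * k + 2 * c ≤ c * c + 2 * k) (m+[n∸m]≡n k≤b) (gap (b ∸ k))
    where
    open ≤-Reasoning
    gap : ∀ d → k * k + 2 * (k + d) ≤ (k + d) * (k + d) + 2 * k
    gap d = begin
        k * k + 2 * (k + d)                    ≡⟨ solve 2 (λ k d → k :* k :+ con 2 :* (k :+ d) := k :* k :+ con 2 :* k :+ con 2 :* (con 1 :* d)) refl k d ⟩
        k * k + 2 * k + 2 * (1 * d)            ≤⟨ +-monoʳ-≤ (k * k + 2 * k) (*-monoʳ-≤ 2 (*-monoˡ-≤ d 1≤k)) ⟩
        k * k + 2 * k + 2 * (k * d)            ≤⟨ m≤m+n _ (d * d) ⟩
        k * k + 2 * k + 2 * (k * d) + d * d    ≡⟨ solve 2 (λ k d → k :* k :+ con 2 :* k :+ con 2 :* (k :* d) :+ d :* d := (k :+ d) :* (k :+ d) :+ con 2 :* k) refl k d ⟩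
        (k + d) * (k + d) + 2 * k              ∎

  -- a ascending, f fixed and k moved vertices, t determined pairs.
  moved-bound : ∀ t a f k n → a * a + 2 * (a * f) ≤ 2 * t + a → k ≤ 2 * a → f + k ≡ n → 1 ≤ k → k * (n ∸ 2) ≤ 8 * t
  moved-bound t a f k n lower k≤2a f+k≡n 1≤k = begin
      k * (n ∸ 2)              ≡⟨ *-distribˡ-∸ k n 2 ⟩
      k * n ∸ k * 2            ≤⟨ ∸-monoˡ-≤ (k * 2) kn≤8t+2k ⟩
      8 * t + k * 2 ∸ k * 2    ≡⟨ m+n∸n≡m (8 * t) (k * 2) ⟩
      8 * t                    ∎
    where
    open ≤-Reasoning
    kn≤8t+2k : k * n ≤ 8 * t + k * 2
    kn≤8t+2k = +-cancelʳ-≤ (2 * (2 * a)) _ _ (begin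
        k * n + 2 * (2 * a)                                ≡⟨ cong (λ m → k * m + 2 * (2 * a)) (sym f+k≡n) ⟩
        k * (f + k) + 2 * (2 * a)                          ≡⟨ solve 4 (λ k f a c → k :* (f :+ k) :+ c := k :* f :+ (k :* k :+ c)) refl k f a (2 * (2 * a)) ⟩
        k * f + (k * k + 2 * (2 * a))                      ≤⟨ +-mono-≤ (*-monoˡ-≤ f k≤2a) (square-gap k (2 * a) 1≤k k≤2a) ⟩
        2 * a * f + (2 * a * (2 * a) + 2 * k)              ≤⟨ m≤m+n _ (6 * (a * f)) ⟩
        2 * a * f + (2 * a * (2 * a) + 2 * k) + 6 * (a * f) ≡⟨ solve 3 (λ a f k → con 2 :* a :* f :+ (con 2 :* a :* (con 2 :* a) :+ con 2 :* k) :+ con 6 :* (a :* f)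
                                                                        := con 4 :* (a :* a :+ con 2 :* (a :* f)) :+ con 2 :* k) refl a f k ⟩
        4 * (a * a + 2 * (a * f)) + 2 * k                  ≤⟨ +-monoˡ-≤ (2 * k) (*-monoʳ-≤ 4 lower) ⟩
        4 * (2 * t + a) + 2 * k
          ≡⟨ solve 3 (λ t a k → con 4 :* (con 2 :* t :+ a) :+ con 2 :* k := con 8 :* t :+ k :* con 2 :+ con 2 :* (con 2 :* a)) refl t a k ⟩
        8 * t + k * 2 + 2 * (2 * a)                        ∎)


module Pairs {n : ℕ} where

  open ListSums
  open import Data.Nat hiding (_≟_)
  open import Data.Nat.Properties hiding (_≟_)
  open import Data.Bool using (Bool; true; false; T; if_then_else_; _∧_; _∨_)
  open import Data.Bool.Properties using (∨-zeroʳ; ∧-zeroʳ; ∧-conicalˡ; ∧-conicalʳ)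
  open import Data.Fin using (Fin; toℕ; _≟_)
  open import Data.Fin.Properties using (toℕ-injective; toℕ<n)
  open import Data.List using (List; []; _∷_; map; concatMap; allFin; filterᵇ)
  open import Data.List.Membership.Propositional using (_∈_)
  open import Data.List.Membership.Propositional.Properties using (∈-map⁺; ∈-allFin)
  open import Data.List.Relation.Unary.Any using (here; there)
  open import Data.Product using (_×_; _,_)
  open import Relation.Nullary using (yes; no; ¬_; contradiction)
  open import Relation.Nullary.Decidable using (⌊_⌋)
  open import Relation.Binary.PropositionalEquality

  Pair : Set
  Pair = Fin n × Fin n

  vertices : List (Fin n)
  vertices = allFin n

  allPairs : List Pair
  allPairs = concatMap (λ x → map (x ,_) vertices) vertices

  ordered : Pair → Bool
  ordered (x , y) = toℕ x <ᵇ toℕ y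

  orderedPairs : List Pair
  orderedPairs = filterᵇ ordered allPairs

  ∈-allPairs : ∀ (p : Pair) → p ∈ allPairs
  ∈-allPairs (x , y) = ∈-concatMap⁺ (λ x → map (x ,_) vertices) vertices (∈-allFin x) (∈-map⁺ (x ,_) (∈-allFin y))

  infix 4 _==_ _==ᴾ_ _∈ᵇ_

  -- Abstract, so that `with p ==ᴾ q` abstracts the comparison itself rather than its unfolding.
  abstract
    _==_ : Fin n → Fin n → Bool
    x == y = ⌊ x ≟ y ⌋

    ==-def : ∀ x y → (x == y) ≡ ⌊ x ≟ y ⌋
    ==-def x y = refl

    ==-sound : ∀ {x y} → (x == y) ≡ true → x ≡ y
    ==-sound {x} {y} h with x ≟ y
    ... | yes x≡y = x≡y

    ==-refl : ∀ x → (x == x) ≡ true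
    ==-refl x with x ≟ x
    ... | yes _ = refl
    ... | no x≢x = contradiction refl x≢x

    ==-false : ∀ {x y} → ¬ x ≡ y → (x == y) ≡ false
    ==-false {x} {y} x≢y with x ≟ y
    ... | yes x≡y = contradiction x≡y x≢y
    ... | no _ = refl

    ==-sym : ∀ x y → (x == y) ≡ (y == x)
    ==-sym x y with x ≟ y | y ≟ x
    ... | yes _ | yes _ = refl
    ... | no _ | no _ = refl
    ... | yes x≡y | no y≢x = contradiction (sym x≡y) y≢x
    ... | no x≢y | yes y≡x = contradiction (sym y≡x) x≢y

    _==ᴾ_ : Pair → Pair → Bool
    (a , b) ==ᴾ (c , d) = (a == c) ∧ (b == d)

    ==ᴾ-sound : ∀ {p q} → (p ==ᴾ q) ≡ true → p ≡ q
    ==ᴾ-sound {a , b} {c , d} h = cong₂ _,_ (==-sound (∧-conicalˡ _ _ h)) (==-sound (∧-conicalʳ _ _ h))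

    ==ᴾ-refl : ∀ p → (p ==ᴾ p) ≡ true
    ==ᴾ-refl (a , b) rewrite ==-refl a | ==-refl b = refl

  _∈ᵇ_ : Pair → List Pair → Bool
  p ∈ᵇ [] = false
  p ∈ᵇ (q ∷ l) = (p ==ᴾ q) ∨ (p ∈ᵇ l)

  ∈⇒∈ᵇ : ∀ {p} l → p ∈ l → (p ∈ᵇ l) ≡ true
  ∈⇒∈ᵇ (q ∷ l) (here refl) rewrite ==ᴾ-refl q = refl
  ∈⇒∈ᵇ {p} (q ∷ l) (there m) = trans (cong ((p ==ᴾ q) ∨_) (∈⇒∈ᵇ l m)) (∨-zeroʳ (p ==ᴾ q))

  ∈ᵇ-filterᵇ : ∀ p (f : Pair → Bool) l → (p ∈ᵇ filterᵇ f l) ≡ (p ∈ᵇ l) ∧ f p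
  ∈ᵇ-filterᵇ p f [] = refl
  ∈ᵇ-filterᵇ p f (q ∷ l) with f q in fq
  ... | true with p ==ᴾ q in p=q
  ...   | true  = sym (subst (λ r → f r ≡ true) (sym (==ᴾ-sound p=q)) fq)
  ...   | false = ∈ᵇ-filterᵇ p f l
  ∈ᵇ-filterᵇ p f (q ∷ l) | false with p ==ᴾ q in p=q
  ...   | false = ∈ᵇ-filterᵇ p f l
  ...   | true  = trans (∈ᵇ-filterᵇ p f l) (trans (cong ((p ∈ᵇ l) ∧_) fp) (trans (∧-zeroʳ (p ∈ᵇ l)) (sym fp)))
    where
    fp : f p ≡ false
    fp = subst (λ r → f r ≡ false) (sym (==ᴾ-sound p=q)) fq

  ∈ᵇ-orderedPairs : ∀ p → (p ∈ᵇ orderedPairs) ≡ ordered p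
  ∈ᵇ-orderedPairs p rewrite ∈ᵇ-filterᵇ p ordered allPairs | ∈⇒∈ᵇ allPairs (∈-allPairs p) = refl

  lookupIn : List Pair → List Bool → Pair → Bool
  lookupIn (q ∷ qs) (b ∷ bs) p = if p ==ᴾ q then b else lookupIn qs bs p
  lookupIn _ _ p = false

  lookupIn-map : ∀ (g : Pair → Bool) p qs → (p ∈ᵇ qs) ≡ true → lookupIn qs (map g qs) p ≡ g p
  lookupIn-map g p (q ∷ qs) h with p ==ᴾ q in p=q
  ... | true rewrite ==ᴾ-sound {p} {q} p=q = refl
  ... | false = lookupIn-map g p qs h

  applyGraph : List Pair → Fin n → Fin n
  applyGraph [] v = v
  applyGraph ((a , b) ∷ l) v = if v == a then b else applyGraph l v

  applyGraph-∈ : ∀ (g : Fin n → Fin n) vs v → v ∈ vs → applyGraph (map (λ w → (w , g w)) vs) v ≡ g v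
  applyGraph-∈ g (w ∷ vs) v (here refl) rewrite ==-refl v = refl
  applyGraph-∈ g (w ∷ vs) v (there v∈vs) with v == w in v=w
  ... | true = cong g (sym (==-sound v=w))
  ... | false = applyGraph-∈ g vs v v∈vs

  applyGraph-∉ : ∀ (g : Fin n → Fin n) vs v → (∀ w → w ∈ vs → ¬ w ≡ v) → applyGraph (map (λ w → (w , g w)) vs) v ≡ v
  applyGraph-∉ g [] v v∉vs = refl
  applyGraph-∉ g (w ∷ vs) v v∉vs with v == w in v=w
  ... | true = contradiction (sym (==-sound v=w)) (v∉vs w (here refl))
  ... | false = applyGraph-∉ g vs v (λ w′ w′∈vs → v∉vs w′ (there w′∈vs))

  rank : Bool → Fin n → ℕ
  rank true x = toℕ x
  rank false x = n ∸ suc (toℕ x)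

  rank<n : ∀ d x → rank d x < n
  rank<n true x = toℕ<n x
  rank<n false x = ∸-monoʳ-< {n} (s≤s z≤n) (toℕ<n x)

  unordered⇒≡ : ∀ {u v : Fin n} → (toℕ u <ᵇ toℕ v) ≡ false → (toℕ v <ᵇ toℕ u) ≡ false → u ≡ v
  unordered⇒≡ u≮v v≮u = toℕ-injective (≤-antisym (≮⇒≥ (λ v<u → subst T v≮u (<⇒<ᵇ v<u))) (≮⇒≥ (λ u<v → subst T u≮v (<⇒<ᵇ u<v))))

-- s guesses σ and dir the orientation.  Fuel 2n suffices since the rank sum increases along determined pairs.
module Decoder {n : ℕ} (s : Fin n → Fin n) (dir : Bool) where

  open ListSums
  open Pairs {n}
  open import Data.Nat hiding (_≟_)
  open import Data.Nat.Properties hiding (_≟_)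
  open import Data.Bool using (Bool; true; false; T; if_then_else_; _∧_; _∨_; not; _xor_)
  open import Data.Fin using (Fin; toℕ)
  open import Data.List using (List; map; filterᵇ)
  open import Data.Vec using (tabulate; lookup)
  open import Data.Vec.Properties using (tabulate∘lookup; tabulate-cong)
  open import Relation.Nullary using (contradiction)
  open import Data.Product using (_×_; _,_; proj₁; proj₂)
  open import Relation.Binary.PropositionalEquality

  ascends : Fin n → Bool
  ascends x = rank dir x <ᵇ rank dir (s x)

  fixed : Fin n → Bool
  fixed x = s x == x

  rises : Fin n → Bool
  rises x = ascends x ∨ fixed x

  determined : Pair → Bool
  determined (x , y) = rises x ∧ rises y ∧ (ascends x ∨ ascends y) ∧ not (x == y)

  determinedPairs freePairs : List Pair
  determinedPairs = filterᵇ determined orderedPairs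
  freePairs = filterᵇ (λ p → not (determined p)) orderedPairs

  readFree : List Bool → Fin n → Fin n → Bool
  readFree bits u v =
    if toℕ u <ᵇ toℕ v then lookupIn freePairs bits (u , v)
    else if toℕ v <ᵇ toℕ u then lookupIn freePairs bits (v , u)
    else false

  flagged : List Pair → Fin n → Fin n → Bool
  flagged flags u v = ((u , v) ∈ᵇ flags) ∨ ((v , u) ∈ᵇ flags)

  decodeEntry : List Bool → List Pair → ℕ → Fin n → Fin n → Bool
  decodeEntry bits flags zero u v = readFree bits u v
  decodeEntry bits flags (suc fuel) u v =
    if determined (u , v) then decodeEntry bits flags fuel (s u) (s v) xor flagged flags u v
    else readFree bits u v

  decode : List Bool → List Pair → Adj n
  decode bits flags = tabulate (λ u → tabulate (λ v → decodeEntry bits flags (2 * n) u v))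

  determined-sym : ∀ x y → determined (x , y) ≡ determined (y , x)
  determined-sym x y rewrite ==-sym x y = swap (rises x) (rises y) (ascends x) (ascends y) (y == x)
    where
    swap : ∀ a b c d e → a ∧ b ∧ (c ∨ d) ∧ not e ≡ b ∧ a ∧ (d ∨ c) ∧ not e
    swap true true true true e = refl
    swap true true true false e = refl
    swap true true false true e = refl
    swap true true false false e = refl
    swap true false c d e = refl
    swap false true c d e = refl
    swap false false c d e = refl

  ascends-rank : ∀ x → ascends x ≡ true → rank dir x < rank dir (s x)
  ascends-rank x a = <ᵇ⇒< _ _ (subst T (sym a) _)

  rises-rank : ∀ x → rises x ≡ true → rank dir x ≤ rank dir (s x)
  rises-rank x h with ascends x in a
  ... | true = <⇒≤ (ascends-rank x a)
  ... | false = ≤-reflexive (cong (rank dir) (sym (==-sound h)))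

  potential : Fin n → Fin n → ℕ
  potential u v = rank dir u + rank dir v

  potential<2n : ∀ u v → potential u v < 2 * n
  potential<2n u v = subst (potential u v <_) (cong (n +_) (sym (+-identityʳ n))) (+-mono-≤ (rank<n dir u) (<⇒≤ (rank<n dir v)))

  determined-parts : ∀ x y → determined (x , y) ≡ true →
                     (rises x ≡ true) × (rises y ≡ true) × ((ascends x ∨ ascends y) ≡ true) × ((x == y) ≡ false)
  determined-parts x y = parts
    where
    parts : ∀ {a b c d} → a ∧ b ∧ c ∧ not d ≡ true → (a ≡ true) × (b ≡ true) × (c ≡ true) × (d ≡ false)
    parts {true} {true} {true} {false} refl = refl , refl , refl , refl

  determined-potential : ∀ u v → determined (u , v) ≡ true → potential u v < potential (s u) (s v)
  determined-potential u v h with determined-parts u v h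
  ... | ru , rv , au∨av , _ = by-cases (ascends u) refl
    where
    by-cases : ∀ b → ascends u ≡ b → potential u v < potential (s u) (s v)
    by-cases true au = +-mono-<-≤ (ascends-rank u au) (rises-rank v rv)
    by-cases false au = +-mono-≤-< (rises-rank u ru) (ascends-rank v (subst (λ b → (b ∨ ascends v) ≡ true) au au∨av))

  determined-distinct : ∀ u v → determined (u , v) ≡ true → (u == v) ≡ false
  determined-distinct u v h = proj₂ (proj₂ (proj₂ (determined-parts u v h)))

  module Encoding (A : Adj n) (A-sym : ∀ u v → adj A u v ≡ adj A v u) (A-irrefl : ∀ u → adj A u u ≡ false) where

    edge : Pair → Bool
    edge p = adj A (proj₁ p) (proj₂ p)

    discrepant : Pair → Bool
    discrepant p = adj A (proj₁ p) (proj₂ p) xor adj A (s (proj₁ p)) (s (proj₂ p))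

    freeBits : List Bool
    freeBits = map edge freePairs

    flags : List Pair
    flags = filterᵇ discrepant determinedPairs

    ∈ᵇ-freePairs : ∀ p → (p ∈ᵇ freePairs) ≡ ordered p ∧ not (determined p)
    ∈ᵇ-freePairs p rewrite ∈ᵇ-filterᵇ p (λ q → not (determined q)) orderedPairs | ∈ᵇ-orderedPairs p = refl

    ∈ᵇ-flags : ∀ p → (p ∈ᵇ flags) ≡ (ordered p ∧ determined p) ∧ discrepant p
    ∈ᵇ-flags p rewrite ∈ᵇ-filterᵇ p discrepant determinedPairs | ∈ᵇ-filterᵇ p determined orderedPairs | ∈ᵇ-orderedPairs p = refl

    readFree-correct : ∀ u v → determined (u , v) ≡ false → readFree freeBits u v ≡ adj A u v
    readFree-correct u v h with toℕ u <ᵇ toℕ v in u<v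
    ... | true = lookupIn-map edge (u , v) freePairs (trans (∈ᵇ-freePairs (u , v)) (cong₂ (λ a b → a ∧ not b) u<v h))
    ... | false with toℕ v <ᵇ toℕ u in v<u
    ...   | true = trans (lookupIn-map edge (v , u) freePairs (trans (∈ᵇ-freePairs (v , u)) (cong₂ (λ a b → a ∧ not b) v<u (trans (determined-sym v u) h))))
                         (A-sym v u)
    ...   | false = trans (sym (A-irrefl u)) (cong (adj A u) (unordered⇒≡ u<v v<u))

    discrepant-sym : ∀ u v → discrepant (v , u) ≡ discrepant (u , v)
    discrepant-sym u v rewrite A-sym v u | A-sym (s v) (s u) = refl

    flagged-correct : ∀ u v → determined (u , v) ≡ true → flagged flags u v ≡ discrepant (u , v)
    flagged-correct u v h
      rewrite ∈ᵇ-flags (u , v) | ∈ᵇ-flags (v , u) | h | trans (determined-sym v u) h | discrepant-sym u v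
      with toℕ u <ᵇ toℕ v in u<v
    ... | true = absorb (toℕ v <ᵇ toℕ u) (discrepant (u , v))
      where
      absorb : ∀ c d → (true ∧ true) ∧ d ∨ (c ∧ true) ∧ d ≡ d
      absorb true true = refl
      absorb true false = refl
      absorb false true = refl
      absorb false false = refl
    ... | false with toℕ v <ᵇ toℕ u in v<u
    ...   | true = refl
    ...   | false with trans (sym (determined-distinct u v h)) (subst (λ w → (u == w) ≡ true) (unordered⇒≡ u<v v<u) (==-refl u))
    ...     | ()

    xor-cancel : ∀ a b → b xor (a xor b) ≡ a
    xor-cancel true true = refl
    xor-cancel true false = refl
    xor-cancel false true = refl
    xor-cancel false false = refl

    decodeEntry-correct : ∀ fuel u v → 2 * n ≤ potential u v + fuel → decodeEntry freeBits flags fuel u v ≡ adj A u v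
    decodeEntry-correct zero u v enough = contradiction (subst (2 * n ≤_) (+-identityʳ (potential u v)) enough) (<⇒≱ (potential<2n u v))
    decodeEntry-correct (suc fuel) u v enough with determined (u , v) in det
    ... | false = readFree-correct u v det
    ... | true = trans (cong₂ _xor_ (decodeEntry-correct fuel (s u) (s v) enough′) (flagged-correct u v det))
                       (xor-cancel (adj A u v) (adj A (s u) (s v)))
      where
      enough′ : 2 * n ≤ potential (s u) (s v) + fuel
      enough′ = ≤-trans enough (subst (_≤ potential (s u) (s v) + fuel) (sym (+-suc (potential u v) fuel)) (+-monoˡ-≤ fuel (determined-potential u v det)))

    decode-encode : decode freeBits flags ≡ A
    decode-encode = trans (tabulate-cong λ u → trans (tabulate-cong λ v → decodeEntry-correct (2 * n) u v (m≤n+m (2 * n) (potential u v)))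
                                                     (tabulate∘lookup (lookup A u)))
                          (tabulate∘lookup A)

module PairCounting where

  open ListSums
  open Pairs
  open import Data.Nat hiding (_≟_)
  open import Data.Nat.Properties hiding (_≟_; suc-injective)
  open import Data.Nat.ListAction using (sum)
  open import Data.Nat.Combinatorics using (_C_; nCk+nC[k+1]≡[n+1]C[k+1]; nC1≡n)
  open import Data.Bool using (Bool; true; false; T; _∧_)
  open import Data.Bool.Properties using (T-≡; ¬-not)
  open import Data.Fin using (Fin; zero; suc; toℕ; _≟_)
  open import Data.Fin.Properties using (toℕ-injective; suc-injective)
  open import Data.List using (List; map; length; tabulate; filterᵇ)
  open import Data.List.Properties using (map-tabulate; length-tabulate; tabulate-cong)
  open import Data.Product using (_,_)
  open import Relation.Binary using (Tri; tri<; tri≈; tri>)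
  open import Relation.Nullary using (yes; no)
  open import Relation.Binary.PropositionalEquality
  open import Function using (_∘_; Equivalence)
  open import Data.Nat.Solver using (module +-*-Solver)
  open +-*-Solver

  T⇒≡true : ∀ {b} → T b → b ≡ true
  T⇒≡true = Equivalence.to T-≡

  ≡true⇒T : ∀ {b} → b ≡ true → T b
  ≡true⇒T = Equivalence.from T-≡

  ==-suc : ∀ {m} (a b : Fin m) → (suc a == suc b) ≡ (a == b)
  ==-suc a b with a ≟ b
  ... | yes refl = trans (==-refl (suc a)) (sym (==-refl a))
  ... | no a≢b = trans (==-false (a≢b ∘ suc-injective)) (sym (==-false a≢b))

  sum-tabulate-0 : ∀ m (h : Fin m → ℕ) → (∀ y → h y ≡ 0) → sum (tabulate h) ≡ 0
  sum-tabulate-0 zero h h≡0 = refl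
  sum-tabulate-0 (suc m) h h≡0 rewrite h≡0 zero = sum-tabulate-0 m (h ∘ suc) (h≡0 ∘ suc)

  sum-tabulate-== : ∀ m (x : Fin m) → sum (tabulate (λ y → 𝟙 (x == y))) ≡ 1
  sum-tabulate-== (suc m) zero rewrite ==-refl (zero {m}) =
    cong suc (sum-tabulate-0 m _ (λ y → cong 𝟙 (==-false (λ ()))))
  sum-tabulate-== (suc m) (suc x) rewrite ==-false {x = suc x} {y = zero} (λ ()) =
    trans (cong sum (tabulate-cong (λ y → cong 𝟙 (==-suc x y)))) (sum-tabulate-== m x)

  2*nC2+n : ∀ n → 2 * (n C 2) + n ≡ n * n
  2*nC2+n zero = refl
  2*nC2+n (suc n) = begin
      2 * (suc n C 2) + suc n        ≡⟨ cong (λ c → 2 * c + suc n) (sym (nCk+nC[k+1]≡[n+1]C[k+1] n 1)) ⟩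
      2 * (n C 1 + n C 2) + suc n    ≡⟨ cong (λ c → 2 * (c + n C 2) + suc n) (nC1≡n n) ⟩
      2 * (n + n C 2) + suc n        ≡⟨ solve 2 (λ n c → con 2 :* (n :+ c) :+ (con 1 :+ n) := (con 2 :* c :+ n) :+ (con 2 :* n :+ con 1)) refl n (n C 2) ⟩
      (2 * (n C 2) + n) + (2 * n + 1) ≡⟨ cong (_+ (2 * n + 1)) (2*nC2+n n) ⟩
      n * n + (2 * n + 1)            ≡⟨ solve 1 (λ n → n :* n :+ (con 2 :* n :+ con 1) := (con 1 :+ n) :* (con 1 :+ n)) refl n ⟩
      suc n * suc n                  ∎
    where open ≡-Reasoning

  module _ {n : ℕ} where

    length-vertices : length (vertices {n}) ≡ n
    length-vertices = length-tabulate (λ i → i)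

    sumOver-vertices-== : ∀ (x : Fin n) → sumOver vertices (λ y → 𝟙 (x == y)) ≡ 1
    sumOver-vertices-== x = trans (cong sum (map-tabulate (λ i → i) (λ y → 𝟙 (x == y)))) (sum-tabulate-== n x)

    sumPairs : (Fin n → Fin n → ℕ) → ℕ
    sumPairs h = sumOver vertices (λ x → sumOver vertices (λ y → h x y))

    sumOver-allPairs : ∀ (h : Pair → ℕ) → sumOver allPairs h ≡ sumPairs (λ x y → h (x , y))
    sumOver-allPairs h = trans (sumOver-concatMap vertices (λ x → map (x ,_) vertices) h) (sumOver-cong vertices (λ x → sumOver-map vertices (x ,_) h))

    length-filterᵇ-allPairs : ∀ q → length (filterᵇ q allPairs) ≡ sumPairs (λ x y → 𝟙 (q (x , y)))
    length-filterᵇ-allPairs q = trans (sym (sumOver-𝟙 allPairs q)) (sumOver-allPairs (λ p → 𝟙 (q p)))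

    sumPairs-cong : ∀ {h h′ : Fin n → Fin n → ℕ} → (∀ x y → h x y ≡ h′ x y) → sumPairs h ≡ sumPairs h′
    sumPairs-cong e = sumOver-cong vertices (λ x → sumOver-cong vertices (e x))

    sumPairs-mono : ∀ {h h′ : Fin n → Fin n → ℕ} → (∀ x y → h x y ≤ h′ x y) → sumPairs h ≤ sumPairs h′
    sumPairs-mono e = sumOver-mono vertices (λ x → sumOver-mono vertices (e x))

    sumPairs-+ : ∀ (h h′ : Fin n → Fin n → ℕ) → sumPairs (λ x y → h x y + h′ x y) ≡ sumPairs h + sumPairs h′
    sumPairs-+ h h′ = trans (sumOver-cong vertices (λ x → sumOver-+ vertices (h x) (h′ x)))
                            (sumOver-+ vertices (λ x → sumOver vertices (h x)) (λ x → sumOver vertices (h′ x)))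

    sumPairs-* : ∀ (f g : Fin n → ℕ) → sumPairs (λ x y → f x * g y) ≡ sumOver vertices f * sumOver vertices g
    sumPairs-* f g = trans (sumOver-cong vertices (λ x → sumOver-*ˡ vertices (f x) g)) (sumOver-*ʳ vertices _ f)

    sumPairs-transpose : ∀ (h : Fin n → Fin n → ℕ) → sumPairs (λ x y → h y x) ≡ sumPairs h
    sumPairs-transpose h = sumOver-comm vertices vertices (λ x y → h y x)

    sumPairs-diagonal : ∀ (f : Fin n → ℕ) → sumPairs (λ x y → f x * 𝟙 (x == y)) ≡ sumOver vertices f
    sumPairs-diagonal f = sumOver-cong vertices λ x → begin
        sumOver vertices (λ y → f x * 𝟙 (x == y)) ≡⟨ sumOver-*ˡ vertices (f x) (λ y → 𝟙 (x == y)) ⟩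
        f x * sumOver vertices (λ y → 𝟙 (x == y)) ≡⟨ cong (f x *_) (sumOver-vertices-== x) ⟩
        f x * 1                                   ≡⟨ *-identityʳ (f x) ⟩
        f x                                       ∎
      where open ≡-Reasoning

    ordered-tri : ∀ (x y : Fin n) → Tri (ordered (x , y) ≡ true) (x ≡ y) (ordered (y , x) ≡ true)
    ordered-tri x y with <-cmp (toℕ x) (toℕ y)
    ... | tri< x<y _ y≮x = tri< (T⇒≡true (<⇒<ᵇ x<y)) (λ x≡y → <-irrefl (cong toℕ x≡y) x<y) (y≮x ∘ <ᵇ⇒< _ _ ∘ ≡true⇒T)
    ... | tri≈ x≮y x≡y y≮x = tri≈ (x≮y ∘ <ᵇ⇒< _ _ ∘ ≡true⇒T) (toℕ-injective x≡y) (y≮x ∘ <ᵇ⇒< _ _ ∘ ≡true⇒T)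
    ... | tri> x≮y _ y<x = tri> (x≮y ∘ <ᵇ⇒< _ _ ∘ ≡true⇒T) (λ x≡y → <-irrefl (cong toℕ (sym x≡y)) y<x) (T⇒≡true (<⇒<ᵇ y<x))

    ordered-split : ∀ (x y : Fin n) → 𝟙 (ordered (x , y)) + 𝟙 (ordered (y , x)) + 𝟙 (x == y) ≡ 1
    ordered-split x y with ordered-tri x y
    ... | tri< x<y x≢y y≮x rewrite x<y | ¬-not y≮x | ==-false x≢y = refl
    ... | tri≈ x≮y refl _ rewrite ¬-not x≮y | ==-refl x = refl
    ... | tri> x≮y x≢y y<x rewrite ¬-not x≮y | y<x | ==-false x≢y = refl

    ordered-split-≢ : ∀ (x y : Fin n) → (x == y) ≡ false → ∀ b → 𝟙 b ≡ 𝟙 (ordered (x , y) ∧ b) + 𝟙 (ordered (y , x) ∧ b)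
    ordered-split-≢ x y x≠y b with ordered-tri x y
    ... | tri< x<y _ y≮x rewrite x<y | ¬-not y≮x = sym (+-identityʳ (𝟙 b))
    ... | tri≈ _ refl _ with trans (sym x≠y) (==-refl x)
    ...   | ()
    ordered-split-≢ x y x≠y b | tri> x≮y _ y<x rewrite ¬-not x≮y | y<x = refl

    sumPairs-1 : sumPairs (λ _ _ → 1) ≡ n * n
    sumPairs-1 = begin
        sumPairs (λ _ _ → 1)                                     ≡⟨ sumOver-cong V (λ _ → sumOver-const V 1) ⟩
        sumOver V (λ _ → length V * 1)                           ≡⟨ sumOver-const V (length V * 1) ⟩
        length V * (length V * 1)                                ≡⟨ cong₂ (λ a b → a * (b * 1)) length-vertices length-vertices ⟩
        n * (n * 1)                                              ≡⟨ cong (n *_) (*-identityʳ n) ⟩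
        n * n                                                    ∎
      where
      open ≡-Reasoning
      V = vertices {n}

    sumPairs-== : sumPairs (λ x y → 𝟙 (x == y)) ≡ n
    sumPairs-== = begin
        sumPairs (λ x y → 𝟙 (x == y))     ≡⟨ sumOver-cong V sumOver-vertices-== ⟩
        sumOver V (λ _ → 1)               ≡⟨ sumOver-const V 1 ⟩
        length V * 1                      ≡⟨ trans (*-identityʳ (length V)) length-vertices ⟩
        n                                 ∎
      where
      open ≡-Reasoning
      V = vertices {n}

    length-orderedPairs : length (orderedPairs {n}) ≡ n C 2
    length-orderedPairs = *-cancelˡ-≡ P (n C 2) 2 (+-cancelʳ-≡ n (2 * P) (2 * (n C 2)) (trans 2P+n≡n*n (sym (2*nC2+n n))))
      where
      open ≡-Reasoning
      P = length (orderedPairs {n})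
      below above diagonal : Fin n → Fin n → ℕ
      below x y = 𝟙 (ordered (x , y))
      above x y = 𝟙 (ordered (y , x))
      diagonal x y = 𝟙 (x == y)
      P≡ : P ≡ sumPairs below
      P≡ = length-filterᵇ-allPairs ordered
      2P+n≡n*n : 2 * P + n ≡ n * n
      2P+n≡n*n = begin
          2 * P + n                                              ≡⟨ cong (λ z → P + z + n) (+-identityʳ P) ⟩
          P + P + n                                              ≡⟨ cong₂ (λ a b → a + b + n) P≡ (trans P≡ (sym (sumPairs-transpose below))) ⟩
          sumPairs below + sumPairs above + n                    ≡⟨ cong (sumPairs below + sumPairs above +_) (sym sumPairs-==) ⟩
          sumPairs below + sumPairs above + sumPairs diagonal    ≡⟨ sym (trans (sumPairs-+ _ diagonal) (cong (_+ sumPairs diagonal) (sumPairs-+ below above))) ⟩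
          sumPairs (λ x y → below x y + above x y + diagonal x y) ≡⟨ sumPairs-cong ordered-split ⟩
          sumPairs (λ _ _ → 1)                                   ≡⟨ sumPairs-1 ⟩
          n * n                                                  ∎

module DeterminedCount {n : ℕ} (s : Fin n → Fin n) where

  open ListSums
  open Pairs {n}
  open PairCounting
  open Estimates using (moved-bound)
  open import Data.Nat hiding (_≟_)
  open import Data.Nat.Properties hiding (_≟_)
  open import Data.Bool using (Bool; true; false; _∧_; _∨_; not)
  open import Data.Fin using (toℕ)
  open import Data.Fin.Properties using (toℕ<n; toℕ-injective)
  open import Data.List using (List; length; filterᵇ)
  open import Data.Product using (Σ; _,_)
  open import Relation.Binary using (tri<; tri≈; tri>)
  open import Relation.Nullary using (yes; no; ¬_)
  open import Relation.Binary.PropositionalEquality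
  open import Data.Nat.Solver using (module +-*-Solver)
  open +-*-Solver

  module Oriented (d : Bool) where

    open Decoder s d public

    #determined #ascending #fixed : ℕ
    #determined = length determinedPairs
    #ascending = length (filterᵇ ascends vertices)
    #fixed = length (filterᵇ fixed vertices)

    sumPairs-determined : sumPairs (λ x y → 𝟙 (determined (x , y))) ≡ 2 * #determined
    sumPairs-determined = begin
        sumPairs (λ x y → 𝟙 (determined (x , y)))       ≡⟨ sumPairs-cong split ⟩
        sumPairs (λ x y → below x y + above x y)         ≡⟨ sumPairs-+ below above ⟩
        sumPairs below + sumPairs above
          ≡⟨ cong (sumPairs below +_) (trans (sumPairs-cong (λ x y → cong (λ b → 𝟙 (ordered (y , x) ∧ b)) (determined-sym x y))) (sumPairs-transpose below)) ⟩
        sumPairs below + sumPairs below                  ≡⟨ cong (λ z → z + z) (sym #determined≡) ⟩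
        #determined + #determined                        ≡⟨ cong (#determined +_) (sym (+-identityʳ #determined)) ⟩
        2 * #determined                                  ∎
      where
      open ≡-Reasoning
      below above : Fin n → Fin n → ℕ
      below x y = 𝟙 (ordered (x , y) ∧ determined (x , y))
      above x y = 𝟙 (ordered (y , x) ∧ determined (x , y))
      #determined≡ : #determined ≡ sumPairs below
      #determined≡ = trans (cong length (filterᵇ-filterᵇ determined ordered allPairs)) (length-filterᵇ-allPairs (λ p → ordered p ∧ determined p))
      split : ∀ x y → 𝟙 (determined (x , y)) ≡ below x y + above x y
      split x y with determined (x , y) in det
      ... | true = ordered-split-≢ x y (determined-distinct x y det) true
      ... | false = none (ordered (x , y)) (ordered (y , x))
        where
        none : ∀ a b → 0 ≡ 𝟙 (a ∧ false) + 𝟙 (b ∧ false)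
        none true true = refl
        none true false = refl
        none false true = refl
        none false false = refl

    ascends⇒¬fixed : ∀ x → ascends x ≡ true → fixed x ≡ false
    ascends⇒¬fixed x a = ==-false (λ sx≡x → <-irrefl (cong (rank d) (sym sx≡x)) (ascends-rank x a))

    -- Off the diagonal, pairs (ascending, fixed), (fixed, ascending) and (ascending, ascending) are determined.
    determined-pointwise : ∀ x y → 𝟙 (ascends x) * 𝟙 (fixed y) + 𝟙 (fixed x) * 𝟙 (ascends y) + 𝟙 (ascends x) * 𝟙 (ascends y)
                                   ≤ 𝟙 (determined (x , y)) + 𝟙 (ascends x) * 𝟙 (x == y)
    determined-pointwise x y with x == y in x=y
    ... | true rewrite sym (==-sound {x} {y} x=y) = ≤-trans (diagonal (ascends x) (fixed x) (ascends⇒¬fixed x)) (m≤n+m _ _)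
      where
      diagonal : ∀ a f → (a ≡ true → f ≡ false) → 𝟙 a * 𝟙 f + 𝟙 f * 𝟙 a + 𝟙 a * 𝟙 a ≤ 𝟙 a * 1
      diagonal true true a⇒¬f with a⇒¬f refl
      ... | ()
      diagonal true false _ = ≤-refl
      diagonal false true _ = z≤n
      diagonal false false _ = z≤n
    ... | false = off-diagonal (ascends x) (fixed x) (ascends y) (fixed y) (ascends⇒¬fixed x) (ascends⇒¬fixed y)
      where
      off-diagonal : ∀ ax fx ay fy → (ax ≡ true → fx ≡ false) → (ay ≡ true → fy ≡ false) →
                     𝟙 ax * 𝟙 fy + 𝟙 fx * 𝟙 ay + 𝟙 ax * 𝟙 ay ≤ 𝟙 ((ax ∨ fx) ∧ (ay ∨ fy) ∧ (ax ∨ ay) ∧ true) + 𝟙 ax * 0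
      off-diagonal true true _ _ ax⇒¬fx _ with ax⇒¬fx refl
      ... | ()
      off-diagonal true false true true _ ay⇒¬fy with ay⇒¬fy refl
      ... | ()
      off-diagonal true false true false _ _ = s≤s z≤n
      off-diagonal true false false true _ _ = s≤s z≤n
      off-diagonal true false false false _ _ = z≤n
      off-diagonal false true true true _ ay⇒¬fy with ay⇒¬fy refl
      ... | ()
      off-diagonal false true true false _ _ = s≤s z≤n
      off-diagonal false true false fy _ _ = z≤n
      off-diagonal false false ay fy _ _ = z≤n

    determined-lower-bound : #ascending * #ascending + 2 * (#ascending * #fixed) ≤ 2 * #determined + #ascending
    determined-lower-bound = begin
        a * a + 2 * (a * f)                        ≡⟨ solve 2 (λ a f → a :* a :+ con 2 :* (a :* f) := a :* f :+ f :* a :+ a :* a) refl a f ⟩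
        a * f + f * a + a * a                      ≡⟨ sym (cong₂ _+_ (cong₂ _+_ (product Σasc Σfix) (product Σfix Σasc)) (product Σasc Σasc)) ⟩
        sumPairs af + sumPairs fa + sumPairs aa    ≡⟨ sym (trans (sumPairs-+ _ aa) (cong (_+ sumPairs aa) (sumPairs-+ af fa))) ⟩
        sumPairs (λ x y → af x y + fa x y + aa x y) ≤⟨ sumPairs-mono determined-pointwise ⟩
        sumPairs (λ x y → det x y + diag x y)      ≡⟨ sumPairs-+ det diag ⟩
        sumPairs det + sumPairs diag               ≡⟨ cong₂ _+_ sumPairs-determined (trans (sumPairs-diagonal asc) Σasc) ⟩
        2 * #determined + a                        ∎
      where
      open ≤-Reasoning
      a = #ascending
      f = #fixed
      asc fix : Fin n → ℕ
      asc x = 𝟙 (ascends x)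
      fix x = 𝟙 (fixed x)
      af fa aa det diag : Fin n → Fin n → ℕ
      af x y = asc x * fix y
      fa x y = fix x * asc y
      aa x y = asc x * asc y
      det x y = 𝟙 (determined (x , y))
      diag x y = asc x * 𝟙 (x == y)
      Σasc : sumOver vertices asc ≡ a
      Σasc = sumOver-𝟙 vertices ascends
      Σfix : sumOver vertices fix ≡ f
      Σfix = sumOver-𝟙 vertices fixed
      product : ∀ {g h : Fin n → ℕ} {G H} → sumOver vertices g ≡ G → sumOver vertices h ≡ H → sumPairs (λ x y → g x * h y) ≡ G * H
      product {g} {h} Σg Σh = trans (sumPairs-* g h) (cong₂ _*_ Σg Σh)

  moves : Fin n → Bool
  moves v = not (s v == v)

  #moved : ℕ
  #moved = length (filterᵇ moves vertices)

  private
    module ↑ = Oriented true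
    module ↓ = Oriented false

  #fixed+#moved : ↑.#fixed + #moved ≡ n
  #fixed+#moved = trans (length-filterᵇ-split (λ v → s v == v) vertices) length-vertices

  moves⇒ascends : ∀ x → 𝟙 (moves x) ≤ 𝟙 (↑.ascends x) + 𝟙 (↓.ascends x)
  moves⇒ascends x with s x == x in sx=x
  ... | true = z≤n
  ... | false with <-cmp (toℕ x) (toℕ (s x))
  ...   | tri< x<sx _ _ rewrite T⇒≡true (<⇒<ᵇ x<sx) = s≤s z≤n
  ...   | tri≈ _ x≡sx _ with trans (sym sx=x) (subst (λ w → (w == x) ≡ true) (toℕ-injective x≡sx) (==-refl x))
  ...     | ()
  moves⇒ascends x | false | tri> _ _ sx<x rewrite T⇒≡true (<⇒<ᵇ (∸-monoʳ-< {n} (s≤s sx<x) (toℕ<n x))) = m≤n+m 1 _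

  #moved≤#ascending : #moved ≤ ↑.#ascending + ↓.#ascending
  #moved≤#ascending = begin
      #moved                                                        ≡⟨ sym (sumOver-𝟙 vertices moves) ⟩
      sumOver vertices (λ x → 𝟙 (moves x))                          ≤⟨ sumOver-mono vertices moves⇒ascends ⟩
      sumOver vertices (λ x → 𝟙 (↑.ascends x) + 𝟙 (↓.ascends x))   ≡⟨ sumOver-+ vertices (λ x → 𝟙 (↑.ascends x)) (λ x → 𝟙 (↓.ascends x)) ⟩
      sumOver vertices (λ x → 𝟙 (↑.ascends x)) + sumOver vertices (λ x → 𝟙 (↓.ascends x))
                                                                    ≡⟨ cong₂ _+_ (sumOver-𝟙 vertices ↑.ascends) (sumOver-𝟙 vertices ↓.ascends) ⟩
      ↑.#ascending + ↓.#ascending                                   ∎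
    where open ≤-Reasoning

  half-≤ : ∀ k a b → ¬ (k ≤ 2 * a) → k ≤ a + b → k ≤ 2 * b
  half-≤ k a b k≰2a k≤a+b = <⇒≤ (+-cancelˡ-< k k (2 * b) (begin-strict
      k + k          ≡⟨ cong (k +_) (sym (+-identityʳ k)) ⟩
      2 * k          ≤⟨ *-monoʳ-≤ 2 k≤a+b ⟩
      2 * (a + b)    ≡⟨ *-distribˡ-+ 2 a b ⟩
      2 * a + 2 * b  <⟨ +-monoˡ-< (2 * b) (≰⇒> k≰2a) ⟩
      k + 2 * b      ∎))
    where open ≤-Reasoning

  -- A moved vertex ascends in one of the two orientations, so one of them has at least #moved/2 ascents.
  some-orientation-determines : 1 ≤ #moved → Σ Bool λ d → #moved * (n ∸ 2) ≤ 8 * Oriented.#determined d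
  some-orientation-determines 1≤k with #moved ≤? 2 * ↑.#ascending
  ... | yes k≤2a = true , moved-bound ↑.#determined ↑.#ascending ↑.#fixed #moved n ↑.determined-lower-bound k≤2a #fixed+#moved 1≤k
  ... | no k≰2a = false , moved-bound ↓.#determined ↓.#ascending ↓.#fixed #moved n ↓.determined-lower-bound
                            (half-≤ #moved ↑.#ascending ↓.#ascending k≰2a #moved≤#ascending) #fixed+#moved 1≤k

-- Every graph with a permutation σ moving k vertices and fewer than kn/200 discrepancies is a
-- decoding for s = σ on its moved vertices, one of the two orientations, and at most budget n · k flags.
module BadGraphs {n : ℕ} where

  open ListSums
  open Pairs {n}
  open PairCounting
  open Estimates
  open import Data.Nat hiding (_≟_)
  open import Data.Nat.Properties hiding (_≟_)
  open import Data.Bool using (Bool; true; false; T; T?; if_then_else_; _∧_; not; _xor_)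
  open import Data.Bool.Properties using (∧-conicalʳ)
  open import Data.Fin using (Fin)
  open import Data.List using (List; []; map; concatMap; length; upTo; filterᵇ)
  open import Data.List.Properties using (length-map; length-upTo; length-filter; filter-≐)
  open import Data.List.Membership.Propositional using (_∈_)
  open import Data.List.Membership.Propositional.Properties using (∈-map⁺; ∈-allFin; ∈-upTo⁺; ∈-filter⁺; ∈-filter⁻)
  open import Data.Product using (_,_; proj₁; proj₂)
  open import Relation.Nullary using (¬_)
  open import Relation.Binary.PropositionalEquality
  open import Function using (_∘_)
  open import Data.Nat.Solver using (module +-*-Solver)
  open +-*-Solver using (solve; _:*_; con; _:=_)

  enoughDetermined : ℕ → (Fin n → Fin n) → Bool → Bool
  enoughDetermined k s d = k * (n ∸ 2) ≤ᵇ 8 * length (Decoder.determinedPairs s d)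

  decodings : ℕ → (Fin n → Fin n) → Bool → List (Adj n)
  decodings k s d =
    concatMap (λ bits → map (Decoder.decode s d bits) (sublistsUpTo (budget n * k) (Decoder.determinedPairs s d)))
              (listsOfLength (length (Decoder.freePairs s d)) bools)

  candidates : ℕ → (Fin n → Fin n) → Bool → List (Adj n)
  candidates k s d = if enoughDetermined k s d then decodings k s d else []

  candidatesMoving : ℕ → List (Adj n)
  candidatesMoving k = concatMap (λ graph → concatMap (candidates k (applyGraph graph)) bools) (listsOfLength k allPairs)

  badCandidates : List (Adj n)
  badCandidates = concatMap (λ j → candidatesMoving (suc j)) (upTo n)

  ∈-candidates : ∀ {A k s d} → enoughDetermined k s d ≡ true → A ∈ decodings k s d → A ∈ candidates k s d
  ∈-candidates enough A∈ rewrite enough = A∈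

  ∈-badCandidates : ∀ {A} k → 1 ≤ k → k ≤ n → A ∈ candidatesMoving k → A ∈ badCandidates
  ∈-badCandidates (suc j) _ k≤n A∈ = ∈-concatMap⁺ (λ j → candidatesMoving (suc j)) (upTo n) (∈-upTo⁺ k≤n) A∈

  module Membership (A : Adj n) (A-simple : IsSimple A) (σ : Fin n → Fin n) where

    A-sym = proj₁ A-simple
    A-irrefl = proj₂ A-simple

    movesσ : Fin n → Bool
    movesσ v = not (σ v == v)

    moved : List (Fin n)
    moved = filterᵇ movesσ vertices

    graph : List Pair
    graph = map (λ v → (v , σ v)) moved

    s₀ : Fin n → Fin n
    s₀ = applyGraph graph

    s₀≡σ : ∀ v → s₀ v ≡ σ v
    s₀≡σ v with movesσ v in mv
    ... | true = applyGraph-∈ σ moved v (∈-filter⁺ (T? ∘ movesσ) (∈-allFin v) (≡true⇒T mv))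
    ... | false = trans (applyGraph-∉ σ moved v w∈moved⇒w≢v) (sym (==-sound (not≡false mv)))
      where
      not≡false : ∀ {b} → not b ≡ false → b ≡ true
      not≡false {true} _ = refl
      w∈moved⇒w≢v : ∀ w → w ∈ moved → ¬ w ≡ v
      w∈moved⇒w≢v w w∈ refl = subst T mv (proj₂ (∈-filter⁻ (T? ∘ movesσ) {xs = vertices} w∈))

    module DC = DeterminedCount s₀

    #moved≡ : DC.#moved ≡ length moved
    #moved≡ = cong length (filter-≐ (T? ∘ DC.moves) (T? ∘ movesσ) (subst T (same _) , subst T (sym (same _))) vertices)
      where
      same : ∀ v → DC.moves v ≡ movesσ v
      same v = cong (λ w → not (w == v)) (s₀≡σ v)

    discrepancies : ℕ
    discrepancies = sumPairs (λ x y → 𝟙 (ordered (x , y) ∧ (adj A x y xor adj A (σ x) (σ y))))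

    module _ (d : Bool) where
      open Decoder s₀ d
      open Encoding A A-sym A-irrefl

      #flags≤discrepancies : length flags ≤ discrepancies
      #flags≤discrepancies = begin
          length (filterᵇ discrepant (filterᵇ determined (filterᵇ ordered allPairs)))
            ≡⟨ cong length (filterᵇ-filterᵇ discrepant determined orderedPairs) ⟩
          length (filterᵇ (λ p → determined p ∧ discrepant p) (filterᵇ ordered allPairs))
            ≤⟨ length-filterᵇ-mono (λ p → determined p ∧ discrepant p) discrepant (λ p h → ≡true⇒T (∧-conicalʳ _ _ (T⇒≡true h))) orderedPairs ⟩
          length (filterᵇ discrepant (filterᵇ ordered allPairs))
            ≡⟨ cong length (filterᵇ-filterᵇ discrepant ordered allPairs) ⟩
          length (filterᵇ (λ p → ordered p ∧ discrepant p) allPairs)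
            ≡⟨ length-filterᵇ-allPairs (λ p → ordered p ∧ discrepant p) ⟩
          sumPairs (λ x y → 𝟙 (ordered (x , y) ∧ discrepant (x , y)))
            ≡⟨ sumPairs-cong (λ x y → cong₂ (λ u v → 𝟙 (ordered (x , y) ∧ (adj A x y xor adj A u v))) (s₀≡σ x) (s₀≡σ y)) ⟩
          discrepancies ∎
        where open ≤-Reasoning

      ∈-decodings : ∀ k → length flags ≤ budget n * k → A ∈ decodings k s₀ d
      ∈-decodings k few = subst (_∈ decodings k s₀ d) decode-encode
        (∈-concatMap⁺ (λ bits → map (decode bits) (sublistsUpTo (budget n * k) determinedPairs)) (listsOfLength (length freePairs) bools)
          (subst (λ m → freeBits ∈ listsOfLength m bools) (length-map edge freePairs) (∈-listsOfLength bools ∈-bools freeBits))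
          (∈-map⁺ (decode freeBits) (filterᵇ-∈-sublistsUpTo discrepant (budget n * k) determinedPairs few)))

    ∈-candidatesMoving : ∀ d → A ∈ candidates (length moved) s₀ d → A ∈ candidatesMoving (length moved)
    ∈-candidatesMoving d A∈ =
      ∈-concatMap⁺ (λ graph → concatMap (candidates (length moved) (applyGraph graph)) bools) (listsOfLength (length moved) allPairs)
        (subst (λ m → graph ∈ listsOfLength m allPairs) (length-map (λ v → (v , σ v)) moved) (∈-listsOfLength allPairs ∈-allPairs graph))
        (∈-concatMap⁺ (candidates (length moved) s₀) bools (∈-bools d) A∈)

    far⇒∈-badCandidates : 200 * discrepancies < n * length moved → A ∈ badCandidates
    far⇒∈-badCandidates far = ∈-badCandidates k 1≤k k≤n (∈-candidatesMoving d (∈-candidates enough (∈-decodings d k few)))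
      where
      k = length moved
      1≤k : 1 ≤ k
      1≤k = n≢0⇒n>0 λ k≡0 → <⇒≱ far (subst (λ m → n * m ≤ 200 * discrepancies) (sym k≡0) (subst (_≤ 200 * discrepancies) (sym (*-zeroʳ n)) z≤n))
      k≤n : k ≤ n
      k≤n = subst (k ≤_) length-vertices (length-filter (T? ∘ movesσ) vertices)
      oriented = DC.some-orientation-determines (subst (1 ≤_) (sym #moved≡) 1≤k)
      d = proj₁ oriented
      enough : enoughDetermined k s₀ d ≡ true
      enough = T⇒≡true (≤⇒≤ᵇ (subst (λ m → m * (n ∸ 2) ≤ 8 * DC.Oriented.#determined d) #moved≡ (proj₂ oriented)))
      few : length (Decoder.Encoding.flags s₀ d A A-sym A-irrefl) ≤ budget n * k
      few = <⇒≤ (*-cancelˡ-< 200 _ _ (begin-strict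
          200 * length (Decoder.Encoding.flags s₀ d A A-sym A-irrefl) ≤⟨ *-monoʳ-≤ 200 (#flags≤discrepancies d) ⟩
          200 * discrepancies                                          <⟨ far ⟩
          n * k                                                        ≤⟨ *-monoˡ-≤ k (n≤200*budget n) ⟩
          200 * budget n * k                                           ≡⟨ *-assoc 200 (budget n) k ⟩
          200 * (budget n * k)                                         ∎))
        where open ≤-Reasoning

  private
    P = length orderedPairs
    F = 16 ^ (n ∸ 2)
    Z = 8 ^ budget n * 15 ^ (n ∸ 2)

  length-decodings : ∀ k s d → length (decodings k s d) ≡ 2 ^ length (Decoder.freePairs s d) * sublistCount (budget n * k) (length (Decoder.determinedPairs s d))
  length-decodings k s d = begin
      length (decodings k s d)
        ≡⟨ length-concatMap (listsOfLength m bools) _ ⟩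
      sumOver (listsOfLength m bools) (λ bits → length (map (decode bits) (sublistsUpTo (budget n * k) determinedPairs)))
        ≡⟨ sumOver-cong (listsOfLength m bools) (λ bits → trans (length-map (decode bits) (sublistsUpTo (budget n * k) determinedPairs))
                                                              (length-sublistsUpTo (budget n * k) determinedPairs)) ⟩
      sumOver (listsOfLength m bools) (λ _ → sublistCount (budget n * k) t)
        ≡⟨ sumOver-const (listsOfLength m bools) _ ⟩
      length (listsOfLength m bools) * sublistCount (budget n * k) t
        ≡⟨ cong (_* sublistCount (budget n * k) t) (length-listsOfLength m bools) ⟩
      2 ^ m * sublistCount (budget n * k) t ∎
    where
    open ≡-Reasoning
    open Decoder s d
    m = length freePairs
    t = length determinedPairs

  length-candidates : ∀ k s d → length (candidates k s d) * F ^ k ≤ 2 ^ P * Z ^ k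
  length-candidates k s d with enoughDetermined k s d in enough
  ... | false = z≤n
  ... | true = begin
      length (decodings k s d) * F ^ k                               ≡⟨ cong₂ _*_ (length-decodings k s d) (^-*-assoc 16 (n ∸ 2) k) ⟩
      2 ^ m * sublistCount (budget n * k) t * 16 ^ ((n ∸ 2) * k)     ≤⟨ block-bound m t P ((n ∸ 2) * k) (budget n * k) m+t≡P K≤8t ⟩
      2 ^ P * 8 ^ (budget n * k) * 15 ^ ((n ∸ 2) * k)                ≡⟨ trans (*-assoc (2 ^ P) _ _) (cong (2 ^ P *_) powers) ⟩
      2 ^ P * Z ^ k                                                   ∎
    where
    open ≤-Reasoning
    open Decoder s d
    m = length freePairs
    t = length determinedPairs
    m+t≡P : m + t ≡ P
    m+t≡P = trans (+-comm m t) (length-filterᵇ-split determined orderedPairs)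
    K≤8t : (n ∸ 2) * k ≤ 8 * t
    K≤8t = subst (_≤ 8 * t) (*-comm k (n ∸ 2)) (≤ᵇ⇒≤ (k * (n ∸ 2)) (8 * t) (≡true⇒T enough))
    powers : 8 ^ (budget n * k) * 15 ^ ((n ∸ 2) * k) ≡ Z ^ k
    powers = sym (trans (^-distribʳ-* (8 ^ budget n) (15 ^ (n ∸ 2)) k) (cong₂ _*_ (^-*-assoc 8 (budget n) k) (^-*-assoc 15 (n ∸ 2) k)))

  length-allPairs : length allPairs ≡ n * n
  length-allPairs = begin
      length allPairs              ≡⟨ sym (*-identityʳ _) ⟩
      length allPairs * 1          ≡⟨ sym (sumOver-const allPairs 1) ⟩
      sumOver allPairs (λ _ → 1)   ≡⟨ sumOver-allPairs {n} (λ _ → 1) ⟩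
      sumPairs {n} (λ _ _ → 1)     ≡⟨ sumPairs-1 {n} ⟩
      n * n                        ∎
    where open ≡-Reasoning

  length-candidatesMoving : ∀ k → length (candidatesMoving k) * F ^ k ≤ (n * n) ^ k * (2 * (2 ^ P * Z ^ k))
  length-candidatesMoving k = begin
      length (candidatesMoving k) * F ^ k
        ≡⟨ cong (_* F ^ k) (length-concatMap (listsOfLength k allPairs) _) ⟩
      sumOver (listsOfLength k allPairs) (λ graph → length (concatMap (candidates k (applyGraph graph)) bools)) * F ^ k
        ≤⟨ sumOver-*-≤ (listsOfLength k allPairs) _ (F ^ k) (2 * (2 ^ P * Z ^ k)) per-graph ⟩
      length (listsOfLength k allPairs) * (2 * (2 ^ P * Z ^ k))
        ≡⟨ cong (_* (2 * (2 ^ P * Z ^ k))) (trans (length-listsOfLength k allPairs) (cong (_^ k) length-allPairs)) ⟩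
      (n * n) ^ k * (2 * (2 ^ P * Z ^ k)) ∎
    where
    open ≤-Reasoning
    per-graph : ∀ graph → length (concatMap (candidates k (applyGraph graph)) bools) * F ^ k ≤ 2 * (2 ^ P * Z ^ k)
    per-graph graph = subst (λ l → l * F ^ k ≤ 2 * (2 ^ P * Z ^ k)) (sym (length-concatMap bools (candidates k (applyGraph graph))))
                        (sumOver-*-≤ bools (λ d → length (candidates k (applyGraph graph) d)) (F ^ k) (2 ^ P * Z ^ k) (length-candidates k (applyGraph graph)))

  length-badCandidates : 531 ≤ n → length badCandidates * 64 ^ n ≤ 63 ^ n * 2 ^ P
  length-badCandidates 531≤n = *-cancelʳ-≤ _ _ n {{>-nonZero 0<n}} (begin
      length badCandidates * 64 ^ n * n
        ≡⟨ trans (*-assoc (length badCandidates) (64 ^ n) n) (cong (length badCandidates *_) (*-comm (64 ^ n) n)) ⟩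
      length badCandidates * (n * 64 ^ n)
        ≡⟨ cong (_* (n * 64 ^ n)) (length-concatMap (upTo n) (λ j → candidatesMoving (suc j))) ⟩
      sumOver (upTo n) (λ j → length (candidatesMoving (suc j))) * (n * 64 ^ n)
        ≤⟨ sumOver-*-≤ (upTo n) (λ j → length (candidatesMoving (suc j))) (n * 64 ^ n) (63 ^ n * 2 ^ P) level ⟩
      length (upTo n) * (63 ^ n * 2 ^ P)
        ≡⟨ trans (cong (_* (63 ^ n * 2 ^ P)) (length-upTo n)) (*-comm n _) ⟩
      63 ^ n * 2 ^ P * n ∎)
    where
    open ≤-Reasoning
    0<n : 0 < n
    0<n = ≤-trans (s≤s z≤n) 531≤n
    X = n * n * Z
    63ⁿ≤n*64ⁿ : 63 ^ n ≤ n * 64 ^ n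
    63ⁿ≤n*64ⁿ = ≤-trans (^-monoˡ-≤ n (n≤1+n 63)) (subst (_≤ n * 64 ^ n) (*-identityˡ (64 ^ n)) (*-monoˡ-≤ (64 ^ n) 0<n))
    ratio : 2 * (X * (n * 64 ^ n)) ≤ 63 ^ n * F
    ratio = subst (_≤ 63 ^ n * F) (regroup n (8 ^ budget n) (15 ^ (n ∸ 2)) (64 ^ n)) (decay n 531≤n)
      where
      regroup : ∀ n E G H → 2 * (n * n * n) * E * G * H ≡ 2 * (n * n * (E * G) * (n * H))
      regroup = solve 4 (λ n E G H → con 2 :* (n :* n :* n) :* E :* G :* H := con 2 :* (n :* n :* (E :* G) :* (n :* H))) refl
    level : ∀ j → length (candidatesMoving (suc j)) * (n * 64 ^ n) ≤ 63 ^ n * 2 ^ P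
    level j = geometric-level {length (candidatesMoving k)} {X} {n * 64 ^ n} {63 ^ n} {F} P j {{m^n≢0 63 n}} {{m^n≢0 16 (n ∸ 2)}}
                63ⁿ≤n*64ⁿ ratio (subst (length (candidatesMoving k) * F ^ k ≤_) regroup (length-candidatesMoving k))
      where
      k = suc j
      regroup : (n * n) ^ k * (2 * (2 ^ P * Z ^ k)) ≡ 2 * (2 ^ P * X ^ k)
      regroup = begin-equality
          (n * n) ^ k * (2 * (2 ^ P * Z ^ k))   ≡⟨ solve 3 (λ w p z → w :* (con 2 :* (p :* z)) := con 2 :* (p :* (w :* z))) refl ((n * n) ^ k) (2 ^ P) (Z ^ k) ⟩
          2 * (2 ^ P * ((n * n) ^ k * Z ^ k))   ≡⟨ cong (λ y → 2 * (2 ^ P * y)) (sym (^-distribʳ-* (n * n) Z k)) ⟩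
          2 * (2 ^ P * X ^ k)                   ∎

module RationalBounds where

  open import Data.Nat as N using (zero; suc)
  import Data.Nat.Properties as NP
  open import Data.Integer as Z using (+_)
  import Data.Integer.Properties as ZP
  open import Data.Rational as Q using (ℚ; mkℚ; _/_; 0ℚ; 1ℚ)
  import Data.Rational.Properties as QP
  open import Data.Rational.Unnormalised as U using (mkℚᵘ; *≡*; *≤*; *<*)
  import Data.Rational.Unnormalised.Properties as UP
  open import Data.Product using (Σ; _×_; _,_)
  open import Relation.Binary.PropositionalEquality

  -- Represents p a b : p = a / (1 + b), compared in ℚᵘ so that no normalisation is involved.
  Represents : ℚ → ℕ → ℕ → Set
  Represents p a b = Q.toℚᵘ p U.≃ mkℚᵘ (+ a) b

  represents-/ : ∀ a b → Represents (+ a / suc b) a b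
  represents-/ a b = QP.toℚᵘ-fromℚᵘ (mkℚᵘ (+ a) b)

  represents-* : ∀ {p q a b c d} → Represents p a b → Represents q c d → Represents (p Q.* q) (a N.* c) (d N.+ b N.* suc d)
  represents-* {mkℚ x y _} {mkℚ z w _} {a} {b} {c} {d} rp rq =
    UP.≃-trans (QP.toℚᵘ-fromℚᵘ (mkℚᵘ (x Z.* z) (w N.+ y N.* suc w)))
      (UP.≃-trans (UP.*-cong rp rq) (*≡* (cong (Z._* (+ suc (d N.+ b N.* suc d))) (sym (ZP.pos-* a c)))))

  represents-≤ : ∀ {p q a b c d} → Represents p a b → Represents q c d → a N.* suc d N.≤ c N.* suc b → p Q.≤ q
  represents-≤ {a = a} {b} {c} {d} rp rq h =
    QP.toℚᵘ-cancel-≤ (UP.≤-respˡ-≃ (UP.≃-sym rp) (UP.≤-respʳ-≃ (UP.≃-sym rq) (*≤* (subst₂ Z._≤_ (ZP.pos-* a (suc d)) (ZP.pos-* c (suc b)) (Z.+≤+ h)))))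

  represents-< : ∀ {p q a b c d} → Represents p a b → Represents q c d → a N.* suc d N.< c N.* suc b → p Q.< q
  represents-< {a = a} {b} {c} {d} rp rq h =
    QP.toℚᵘ-cancel-< (UP.<-respˡ-≃ (UP.≃-sym rp) (UP.<-respʳ-≃ (UP.≃-sym rq) (*<* (subst₂ Z._<_ (ZP.pos-* a (suc d)) (ZP.pos-* c (suc b)) (Z.+<+ h)))))

  γ q : ℚ
  γ = + 1 / 200
  q = + 63 / 64

  0<γ : 0ℚ Q.< γ
  0<γ = represents-< (represents-/ 0 0) (represents-/ 1 199) (N.s≤s N.z≤n)

  0<q : 0ℚ Q.< q
  0<q = represents-< (represents-/ 0 0) (represents-/ 63 63) (N.s≤s N.z≤n)

  q<1 : q Q.< 1ℚ
  q<1 = represents-< (represents-/ 63 63) (represents-/ 1 0) (NP.≤ᵇ⇒≤ _ _ _)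

  γn*k≤D : ∀ n k D → n N.* k N.≤ 200 N.* D → (γ Q.* ℕ→ℚ n) Q.* ℕ→ℚ k Q.≤ ℕ→ℚ D
  γn*k≤D n k D h = represents-≤ (represents-* (represents-* (represents-/ 1 199) (represents-/ n 0)) (represents-/ k 0)) (represents-/ D 0)
    (subst₂ N._≤_ (sym (trans (NP.*-identityʳ _) (cong (N._* k) (NP.*-identityˡ n)))) (NP.*-comm 200 D) h)

  represents-q^ : ∀ n → Σ ℕ λ b → (suc b ≡ 64 N.^ n) × Represents (q ^ℚ n) (63 N.^ n) b
  represents-q^ zero = 0 , refl , represents-/ 1 0
  represents-q^ (suc n) with represents-q^ n
  ... | b , 1+b≡64ⁿ , r = b N.+ 63 N.* suc b , cong (64 N.*_) 1+b≡64ⁿ , represents-* (represents-/ 63 63) r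

  L≤qⁿ*M : ∀ n L M → L N.* 64 N.^ n N.≤ 63 N.^ n N.* M → ℕ→ℚ L Q.≤ (q ^ℚ n) Q.* ℕ→ℚ M
  L≤qⁿ*M n L M h with represents-q^ n
  ... | b , 1+b≡64ⁿ , r = represents-≤ (represents-/ L 0) (represents-* r (represents-/ M 0))
    (subst₂ N._≤_ (cong (L N.*_) (sym (trans (cong suc (NP.*-identityʳ b)) 1+b≡64ⁿ))) (sym (NP.*-identityʳ _)) h)

module SelfOrdering {n : ℕ} (A : Adj n) (A-simple : IsSimple A) where

  open ListSums
  open Pairs {n}
  open PairCounting
  open RationalBounds using (γ; γn*k≤D)
  open BadGraphs {n}
  open import Data.Nat as N using (_≤?_)
  open import Data.Nat.Properties using (≰⇒>)
  open import Data.Bool using (true; false; if_then_else_) renaming (_≟_ to _≟ᵇ_)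
  open import Data.Fin using (_≟_)
  open import Data.Fin.Permutation using (Permutation′; _⟨$⟩ˡ_)
  open import Data.List using (length)
  open import Data.List.Membership.Propositional using (_∈_)
  open import Data.List.Relation.Unary.Any using (any?)
  open import Data.Vec.Properties using (≡-dec)
  open import Data.Rational using (_≤_; _*_)
  open import Relation.Nullary using (yes; no; ¬_; contradiction)
  open import Relation.Nullary.Decidable using (⌊_⌋)
  open import Relation.Binary.PropositionalEquality

  module _ (π : Permutation′ n) where

    open Membership A A-simple (π ⟨$⟩ˡ_)

    movedCount≡ : movedCount π ≡ length moved
    movedCount≡ = trans (sumOver-cong vertices indicator) (sumOver-𝟙 vertices movesσ)
      where
      indicator : ∀ v → (if ⌊ π ⟨$⟩ˡ v ≟ v ⌋ then 0 else 1) ≡ 𝟙 (movesσ v)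
      indicator v rewrite ==-def (π ⟨$⟩ˡ v) v with ⌊ π ⟨$⟩ˡ v ≟ v ⌋
      ... | true = refl
      ... | false = refl

    symDiffSize≡ : symDiffSize A π ≡ discrepancies
    symDiffSize≡ = sum-concatMap vertices _

    ∉⇒robust-at : ¬ A ∈ badCandidates → (γ * ℕ→ℚ n) * ℕ→ℚ (movedCount π) ≤ ℕ→ℚ (symDiffSize A π)
    ∉⇒robust-at A∉ with n N.* movedCount π ≤? 200 N.* symDiffSize A π
    ... | yes close = γn*k≤D n (movedCount π) (symDiffSize A π) close
    ... | no far = contradiction (far⇒∈-badCandidates (subst₂ (λ D k → 200 N.* D N.< n N.* k) symDiffSize≡ movedCount≡ (≰⇒> far))) A∉

  not-robust⇒∈-badCandidates : ¬ RobustlySelfOrdered (γ * ℕ→ℚ n) A → A ∈ badCandidates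
  not-robust⇒∈-badCandidates not-robust with any? (≡-dec (≡-dec _≟ᵇ_) A) badCandidates
  ... | yes A∈ = A∈
  ... | no A∉ = contradiction (λ π → ∉⇒robust-at π A∉) not-robust

open import Data.Nat as N using (_≥_; _^_)
open import Data.Nat.Combinatorics using (_C_)
open import Data.List using (length)
open import Data.Product using (Σ; _×_; _,_)
open import Data.Rational using (ℚ; _<_; _≤_; _*_; 0ℚ; 1ℚ)
open import Relation.Binary.PropositionalEquality using (subst)
open RationalBounds using (γ; q; 0<γ; 0<q; q<1; L≤qⁿ*M)
open BadGraphs using (badCandidates; length-badCandidates)
open PairCounting using (length-orderedPairs)

#badCandidates≤qⁿ*2^[nC2] : ∀ n → n ≥ 531 → ℕ→ℚ (length (badCandidates {n})) ≤ (q ^ℚ n) * ℕ→ℚ (2 ^ (n C 2))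
#badCandidates≤qⁿ*2^[nC2] n 531≤n =
  L≤qⁿ*M n (length (badCandidates {n})) (2 ^ (n C 2))
    (subst (λ P → length (badCandidates {n}) N.* 64 ^ n N.≤ 63 ^ n N.* 2 ^ P) (length-orderedPairs {n}) (length-badCandidates {n} 531≤n))

proposition7p1 :
    Σ ℚ λ γ → (0ℚ < γ) ×
      (Σ ℚ λ q → (0ℚ < q) × (q < 1ℚ) ×
        (Σ ℕ λ n₀ → ∀ (n : ℕ) → n ≥ n₀ →
          BadCountAtMost n (γ * ℕ→ℚ n) ((q ^ℚ n) * ℕ→ℚ (2 ^ (n C 2)))))
proposition7p1 = γ , 0<γ , q , 0<q , q<1 , 531 , λ n 531≤n →
  badCandidates , #badCandidates≤qⁿ*2^[nC2] n 531≤n , SelfOrdering.not-robust⇒∈-badCandidates
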